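{- Let $p>2$ be a prime number. Every $2$-radius sequence over a $2p$-element alphabet has length at least $p^2+p$; hence $f_2(2p)=p^2+p$, and the sequence $IT'$ (defined in the context) is a shortest $2$-radius sequence over the $2p$-element alphabet $X$.
   Context: A sequence $x_1,\ldots,x_m$ over an alphabet $X$ is a $2$-radius sequence if for every $a,b\in X$ there are indices $i,j$ with $x_i=a$, $x_j=b$, $|i-j|\leq 2$; $f_2(n)$ is the length of a shortest $2$-radius sequence over an $n$-element alphabet. Let $p>2$ be prime, $X=\{0,\ldots,p-1\}\cup\{\underline{0},\ldots,\underline{p-1}\}$, with $A=\{0,\ldots,p-1\}$ and $\underline{A}=\{\underline{0},\ldots,\underline{p-1}\}$ each identified with $\mathbb{Z}_p$ (arithmetic mod $p$). Let $h=\frac{p-1}{2}$. For $j\in\{1,\ldots,h\}$ and $m=0,\ldots,2p-1$ let $x^{(j)}_m=(mj\bmod p)\in A$ if $m$ is even and $x^{(j)}_m=\underline{mj\bmod p}$ if $m$ is odd. Let $r_j$ be the unique odd integer in $\{1,\ldots,2p-1\}$ with $r_jj\equiv 1\pmod p$; $I_j'=x^{(j)}_0,\ldots,x^{(j)}_{r_j-1}$, $I_j''=x^{(j)}_{r_j},\ldots,x^{(j)}_{2p-1}$. Let $J_j=I_j'$ for $j$ odd, $J_j=I_j''$ for $j$ even; $\hat J_j=I_j''$ for $j$ odd, $\hat J_j=I_j'$ for $j$ even; $I=J_1\cdots J_h\hat J_h\cdots\hat J_1$. Let $T=(t_1,\ldots,t_{2p})$ with $t_i=\underline{ -\frac{i-1}{2}}$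 ($i\equiv1$ mod 4), $t_i=-\frac{i-2}{2}$ ($i\equiv2$ mod 4), $t_i=\frac{i+1}{2}$ ($i\equiv3$ mod 4), $t_i=\underline{\frac i2}$ ($i\equiv0$ mod 4), values mod $p$; $T'$ is $T$ with its first two terms swapped; $IT'$ is the concatenation. -}

module Defs where

open import Data.Nat using (ℕ; zero; suc; _+_; _*_; _∸_; _≤_; NonZero; _≡ᵇ_)
open import Data.Nat.DivMod using (_/_; _%_; _mod_)
open import Data.Bool using (Bool; true; false; if_then_else_)
open import Data.Fin using (Fin; toℕ)
open import Data.Sum using (_⊎_; inj₁; inj₂)
open import Data.Product using (Σ; _×_; ∃; _,_)
open import Data.List using (List; []; _∷_; length; lookup; map; upTo; take; drop; concat; reverse; _++_)
open import Relation.Binary.PropositionalEquality using (_≡_)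

IsTwoRadius : {X : Set} → List X → Set
IsTwoRadius {X} xs =
  ∀ (a b : X) → Σ (Fin (length xs)) λ i → Σ (Fin (length xs)) λ j →
    lookup xs i ≡ a × lookup xs j ≡ b ×
    toℕ i ≤ toℕ j + 2 × toℕ j ≤ toℕ i + 2

IsF2 : ℕ → ℕ → Set
IsF2 n m =
  (Σ (List (Fin n)) λ xs → IsTwoRadius xs × length xs ≡ m) ×
  (∀ (xs : List (Fin n)) → IsTwoRadius xs → m ≤ length xs)

IsShortestTwoRadius : {X : Set} → List X → Set
IsShortestTwoRadius {X} xs =
  IsTwoRadius xs × (∀ (ys : List X) → IsTwoRadius ys → length xs ≤ length ys)

-- The construction IT'.  Alphabet X = A ⊎ A̲ with A = A̲ = ℤ_p = Fin p;
-- inj₁ a is a ∈ A, inj₂ a is the underlined a̲.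

module Construction (p : ℕ) .{{_ : NonZero p}} where

  Alph : Set
  Alph = Fin p ⊎ Fin p

  pos : ℕ → Fin p
  pos k = k mod p

  neg : ℕ → Fin p
  neg k = (p ∸ (k % p)) mod p

  h : ℕ
  h = (p ∸ 1) / 2

  even : ℕ → Bool
  even m = (m % 2) ≡ᵇ 0

  x : ℕ → ℕ → Alph
  x j m = if even m then inj₁ (pos (m * j)) else inj₂ (pos (m * j))

  row : ℕ → List Alph
  row j = map (x j) (upTo (2 * p))

  search : ℕ → List ℕ → ℕ
  search j [] = 0
  search j (r ∷ rs) =
    if (r % 2 ≡ᵇ 1) Data.Bool.∧ ((r * j) % p ≡ᵇ 1 % p) then r else search j rs

  -- r_j : the unique odd r ∈ {1,…,2p-1} with r j ≡ 1 (mod p)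
  r : ℕ → ℕ
  r j = search j (map suc (upTo (2 * p ∸ 1)))

  I′ I″ : ℕ → List Alph
  I′ j = take (r j) (row j)
  I″ j = drop (r j) (row j)

  J Ĵ : ℕ → List Alph
  J j = if even j then I″ j else I′ j
  Ĵ j = if even j then I′ j else I″ j

  js : List ℕ
  js = map suc (upTo h)

  I : List Alph
  I = concat (map J js) ++ concat (map Ĵ (reverse js))

  t : ℕ → Alph
  t i with i % 4
  ... | 1 = inj₂ (neg ((i ∸ 1) / 2))
  ... | 2 = inj₁ (neg ((i ∸ 2) / 2))
  ... | 3 = inj₁ (pos ((i + 1) / 2))
  ... | _ = inj₂ (pos (i / 2))

  T : List Alph
  T = map (λ k → t (suc k)) (upTo (2 * p))

  swap12 : List Alph → List Alph
  swap12 (a ∷ b ∷ rest) = b ∷ a ∷ rest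
  swap12 l = l

  T′ : List Alph
  T′ = swap12 T

  IT′ : List Alph
  IT′ = I ++ T′

IT′ : (p : ℕ) .{{_ : NonZero p}} → List (Fin p ⊎ Fin p)
IT′ p = Construction.IT′ p

module Submission where

-- In a 2-radius sequence over n letters, a letter a must be
-- within distance 2 of every other letter, and each occurrence of a has at
-- most four letters within that distance; so n ≤ 1 + 4·(occurrences of a).
-- For n = 2p with p = 2q + 1 every letter therefore occurs at least q + 1
-- times, and summing over the alphabet gives length ≥ 2p(q + 1) = p² + p.
--
-- For 1 ≤ j ≤ q the row x^{(j)}_m = m j mod p (m < 2p, even
-- m in A, odd m in A̲) is cut at r_j into I′ j and I″ j.  IT′ is arranged so
-- that each row is traversed cyclically: within its halves by position,
-- across the cut and across its end by the block that follows, while the two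
-- pairs at distance two straddling those places occur in T′.  Letters on the
-- same side differing by ±2j, and letters on opposite sides differing by
-- ±j, are therefore near in IT′; every pair of distinct letters is of this
-- kind, and T′ also contains every pair {c, c̲}.  So IT′ is a 2-radius
-- sequence, of length q·2p + 2p = p² + p.

open import Defs
open import Data.Nat using (ℕ; zero; suc; _+_; _*_; _<_; _≤_; NonZero)
open import Data.Nat.Primality using (Prime; prime⇒nonZero)
open import Data.Fin using (Fin)
open import Data.List using (List; length)
open import Data.Product using (_×_; _,_)
open import Relation.Binary.PropositionalEquality using (_≡_; refl)

-- Wrapped in a record so that both sides stay inferable.
module Modular (p : ℕ) .{{_ : NonZero p}} where

  open import Data.Nat using (_∸_)
  open import Data.Nat.Properties using (+-assoc; +-comm; +-identityʳ; m+[n∸m]≡n)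
  open import Data.Nat.DivMod
    using (_%_; %-distribˡ-+; %-distribˡ-*; m%n%n≡m%n; m*n%n≡0; [m+kn]%n≡m%n; m<n⇒m%n≡m; m%n<n; m%n≤n)
  open import Data.Fin using (toℕ)
  open import Data.Fin.Properties using (toℕ-injective; toℕ<n; toℕ-fromℕ<)
  open import Relation.Binary.Bundles using (Setoid)
  import Relation.Binary.Reasoning.Setoid as SetoidReasoning
  open import Relation.Binary.PropositionalEquality

  open Construction p using (pos; neg)

  infix 4 _≈_
  record _≈_ (a b : ℕ) : Set where
    constructor ≈i
    field residue : a % p ≡ b % p
  open _≈_ public

  ≈-refl : ∀ {a} → a ≈ a
  ≈-refl = ≈i refl

  ≈-sym : ∀ {a b} → a ≈ b → b ≈ a
  ≈-sym (≈i e) = ≈i (sym e)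

  ≈-trans : ∀ {a b c} → a ≈ b → b ≈ c → a ≈ c
  ≈-trans (≈i e) (≈i f) = ≈i (trans e f)

  ≡⇒≈ : ∀ {a b} → a ≡ b → a ≈ b
  ≡⇒≈ refl = ≈-refl

  ≈-setoid : Setoid _ _
  ≈-setoid = record
    { Carrier = ℕ ; _≈_ = _≈_
    ; isEquivalence = record { refl = ≈-refl ; sym = ≈-sym ; trans = ≈-trans } }

  module ≈-Reasoning = SetoidReasoning ≈-setoid

  ≈-+ : ∀ {a b c d} → a ≈ b → c ≈ d → a + c ≈ b + d
  ≈-+ {a} {b} {c} {d} (≈i e₁) (≈i e₂) = ≈i (begin
    (a + c) % p           ≡⟨ %-distribˡ-+ a c p ⟩
    (a % p + c % p) % p   ≡⟨ cong₂ (λ x y → (x + y) % p) e₁ e₂ ⟩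
    (b % p + d % p) % p   ≡⟨ %-distribˡ-+ b d p ⟨
    (b + d) % p           ∎)
    where open ≡-Reasoning

  ≈-* : ∀ {a b c d} → a ≈ b → c ≈ d → a * c ≈ b * d
  ≈-* {a} {b} {c} {d} (≈i e₁) (≈i e₂) = ≈i (begin
    (a * c) % p               ≡⟨ %-distribˡ-* a c p ⟩
    (a % p * (c % p)) % p     ≡⟨ cong₂ (λ x y → (x * y) % p) e₁ e₂ ⟩
    (b % p * (d % p)) % p     ≡⟨ %-distribˡ-* b d p ⟨
    (b * d) % p               ∎)
    where open ≡-Reasoning

  %≈ : ∀ a → a % p ≈ a
  %≈ a = ≈i (m%n%n≡m%n a p)

  *p≈0 : ∀ k → k * p ≈ 0
  *p≈0 k = ≈i (trans (m*n%n≡0 k p) (sym (m*n%n≡0 0 p)))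

  p≈0 : p ≈ 0
  p≈0 = ≈-trans (≡⇒≈ (sym (+-identityʳ p))) (*p≈0 1)

  +*p : ∀ a k → a + k * p ≈ a
  +*p a k = ≈i ([m+kn]%n≡m%n a k p)

  +p : ∀ a → a + p ≈ a
  +p a = ≈-trans (≡⇒≈ (cong (a +_) (sym (+-identityʳ p)))) (+*p a 1)

  +-inverse : ∀ x c → x + c + (p ∸ c % p) ≈ x
  +-inverse x c = begin
    x + c + (p ∸ c % p)       ≈⟨ ≈-+ (≈-+ (≈-refl {x}) (≈-sym (%≈ c))) ≈-refl ⟩
    x + c % p + (p ∸ c % p)   ≡⟨ +-assoc x (c % p) _ ⟩
    x + (c % p + (p ∸ c % p)) ≡⟨ cong (x +_) (m+[n∸m]≡n (m%n≤n c p)) ⟩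
    x + p                     ≈⟨ +p x ⟩
    x                         ∎
    where open ≈-Reasoning

  ≈-cancelʳ : ∀ {a b} c → a + c ≈ b + c → a ≈ b
  ≈-cancelʳ {a} {b} c e = begin
    a                         ≈⟨ +-inverse a c ⟨
    a + c + (p ∸ c % p)       ≈⟨ ≈-+ e ≈-refl ⟩
    b + c + (p ∸ c % p)       ≈⟨ +-inverse b c ⟩
    b                         ∎
    where open ≈-Reasoning

  toℕ-pos : ∀ k → toℕ (pos k) ≡ k % p
  toℕ-pos k = toℕ-fromℕ< (m%n<n k p)

  pos-≈ : ∀ {a b} → a ≈ b → pos a ≡ pos b
  pos-≈ {a} {b} (≈i e) = toℕ-injective (trans (toℕ-pos a) (trans e (sym (toℕ-pos b))))

  pos-toℕ : ∀ (c : Fin p) → pos (toℕ c) ≡ c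
  pos-toℕ c = toℕ-injective (trans (toℕ-pos (toℕ c)) (m<n⇒m%n≡m (toℕ<n c)))

  neg-≈ : ∀ k {n} → k + n ≈ 0 → neg k ≡ pos n
  neg-≈ k {n} e = pos-≈ (≈-cancelʳ k (begin
    (p ∸ k % p) + k           ≡⟨ +-comm (p ∸ k % p) k ⟩
    k + (p ∸ k % p)           ≈⟨ +-inverse 0 k ⟩
    0                         ≈⟨ e ⟨
    k + n                     ≡⟨ +-comm k n ⟩
    n + k                     ∎))
    where open ≈-Reasoning

-- Adj xs a b says that b occurs one or
-- two places after an occurrence of a in xs; this is the combinatorial
-- content of IsTwoRadius, but stated by decomposing the list, so that it
-- transfers along concatenation, reversal and map.
module Windows where

  open import Data.Nat using (z≤n; s≤s)
  open import Data.Fin using (toℕ) renaming (zero to fzero; suc to fsuc)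
  open import Data.List using ([]; _∷_; lookup; map; reverse; _++_)
  open import Data.List.Properties using (++-assoc; reverse-++; map-++)
  open import Data.List.Membership.Propositional using (_∈_)
  open import Data.List.Membership.Propositional.Properties using (∈-++⁺ʳ; ∈-map⁺; ∈-lookup)
  open import Data.List.Relation.Unary.Any using (here; there)
  open import Data.Product using (Σ)
  open import Data.Sum using (_⊎_; inj₁; inj₂)
  open import Relation.Binary.PropositionalEquality using (sym; trans; cong; subst; subst₂; module ≡-Reasoning)

  data Adj {A : Set} (xs : List A) (a b : A) : Set where
    adj1 : (X Y : List A) → xs ≡ X ++ a ∷ b ∷ Y → Adj xs a b
    adj2 : (X : List A) (c : A) (Y : List A) → xs ≡ X ++ a ∷ c ∷ b ∷ Y → Adj xs a b

  Succ : {A : Set} → List A → A → A → Set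
  Succ {A} xs u v = Σ (List A) λ X → Σ (List A) λ Y → xs ≡ X ++ u ∷ v ∷ Y

  Near : {A : Set} → List A → A → A → Set
  Near xs a b = Adj xs a b ⊎ Adj xs b a

  Close : {A : Set} → List A → A → A → Set
  Close xs a b = Σ (Fin (length xs)) λ i → Σ (Fin (length xs)) λ j →
    lookup xs i ≡ a × lookup xs j ≡ b × toℕ i ≤ toℕ j + 2 × toℕ j ≤ toℕ i + 2

  module _ {A : Set} where

    Near-sym : ∀ {xs : List A} {a b} → Near xs a b → Near xs b a
    Near-sym (inj₁ ad) = inj₂ ad
    Near-sym (inj₂ ad) = inj₁ ad

    private
      reassoc : ∀ (X P zs Q Y : List A) → X ++ (P ++ zs ++ Q) ++ Y ≡ (X ++ P) ++ zs ++ (Q ++ Y)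
      reassoc X P zs Q Y = begin
        X ++ (P ++ zs ++ Q) ++ Y   ≡⟨ cong (X ++_) (++-assoc P (zs ++ Q) Y) ⟩
        X ++ P ++ (zs ++ Q) ++ Y   ≡⟨ cong (λ l → X ++ P ++ l) (++-assoc zs Q Y) ⟩
        X ++ P ++ zs ++ Q ++ Y     ≡⟨ ++-assoc X P (zs ++ Q ++ Y) ⟨
        (X ++ P) ++ zs ++ Q ++ Y   ∎
        where open ≡-Reasoning

      reverse-middle : ∀ (X zs Y : List A) → reverse (X ++ zs ++ Y) ≡ reverse Y ++ reverse zs ++ reverse X
      reverse-middle X zs Y = begin
        reverse (X ++ zs ++ Y)                 ≡⟨ reverse-++ X (zs ++ Y) ⟩
        reverse (zs ++ Y) ++ reverse X         ≡⟨ cong (_++ reverse X) (reverse-++ zs Y) ⟩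
        (reverse Y ++ reverse zs) ++ reverse X ≡⟨ ++-assoc (reverse Y) (reverse zs) (reverse X) ⟩
        reverse Y ++ reverse zs ++ reverse X   ∎
        where open ≡-Reasoning

    Adj-infix : ∀ {L : List A} {a b} (X Y : List A) → Adj L a b → Adj (X ++ L ++ Y) a b
    Adj-infix {a = a} {b} X Y (adj1 P Q refl) = adj1 (X ++ P) (Q ++ Y) (reassoc X P (a ∷ b ∷ []) Q Y)
    Adj-infix {a = a} {b} X Y (adj2 P c Q refl) = adj2 (X ++ P) c (Q ++ Y) (reassoc X P (a ∷ c ∷ b ∷ []) Q Y)

    Succ⇒Adj : ∀ {xs : List A} {u v} → Succ xs u v → Adj xs u v
    Succ⇒Adj (X , Y , e) = adj1 X Y e

    Succ-++ˡ : ∀ {L : List A} {u v} (R : List A) → Succ L u v → Succ (L ++ R) u v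
    Succ-++ˡ {u = u} {v} R (X , Y , refl) = X , Y ++ R , ++-assoc X (u ∷ v ∷ Y) R

    Succ-++ʳ : ∀ {R : List A} {u v} (L : List A) → Succ R u v → Succ (L ++ R) u v
    Succ-++ʳ {u = u} {v} L (X , Y , refl) = L ++ X , Y , sym (++-assoc L X (u ∷ v ∷ Y))

    Succ-junction : ∀ {L R : List A} {X Y u v} → L ≡ X ++ u ∷ [] → R ≡ v ∷ Y → Succ (L ++ R) u v
    Succ-junction {X = X} {Y} {u} {v} refl refl = X , Y , ++-assoc X (u ∷ []) (v ∷ Y)

    Succ-reverse : ∀ {xs : List A} {u v} → Succ xs u v → Succ (reverse xs) v u
    Succ-reverse {u = u} {v} (X , Y , refl) = reverse Y , reverse X , reverse-middle X (u ∷ v ∷ []) Y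

    Adj-cons : ∀ {xs : List A} {a b} (x : A) → Adj xs a b → Adj (x ∷ xs) a b
    Adj-cons x (adj1 X Y refl) = adj1 (x ∷ X) Y refl
    Adj-cons x (adj2 X c Y refl) = adj2 (x ∷ X) c Y refl

    Adj-reverse : ∀ {xs : List A} {a b} → Adj xs a b → Adj (reverse xs) b a
    Adj-reverse {a = a} {b} (adj1 X Y refl) = adj1 (reverse Y) (reverse X) (reverse-middle X (a ∷ b ∷ []) Y)
    Adj-reverse {a = a} {b} (adj2 X c Y refl) = adj2 (reverse Y) c (reverse X) (reverse-middle X (a ∷ c ∷ b ∷ []) Y)

    Adj-∈ˡ : ∀ {xs : List A} {a b} → Adj xs a b → a ∈ xs
    Adj-∈ˡ (adj1 X Y refl) = ∈-++⁺ʳ X (here refl)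
    Adj-∈ˡ (adj2 X c Y refl) = ∈-++⁺ʳ X (here refl)

    Adj-∈ʳ : ∀ {xs : List A} {a b} → Adj xs a b → b ∈ xs
    Adj-∈ʳ (adj1 X Y refl) = ∈-++⁺ʳ X (there (here refl))
    Adj-∈ʳ (adj2 X c Y refl) = ∈-++⁺ʳ X (there (there (here refl)))

    Near-∈ˡ : ∀ {xs : List A} {a b} → Near xs a b → a ∈ xs
    Near-∈ˡ (inj₁ ad) = Adj-∈ˡ ad
    Near-∈ˡ (inj₂ ad) = Adj-∈ʳ ad

    Near-∈ʳ : ∀ {xs : List A} {a b} → Near xs a b → b ∈ xs
    Near-∈ʳ (inj₁ ad) = Adj-∈ʳ ad
    Near-∈ʳ (inj₂ ad) = Adj-∈ˡ ad

    Close-sym : ∀ {xs : List A} {a b} → Close xs a b → Close xs b a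
    Close-sym (i , j , eᵢ , eⱼ , i≤ , j≤) = j , i , eⱼ , eᵢ , j≤ , i≤

    Close-++ : ∀ {xs : List A} {a b} (X : List A) → Close xs a b → Close (X ++ xs) a b
    Close-++ [] c = c
    Close-++ (x ∷ X) c with Close-++ X c
    ... | i , j , eᵢ , eⱼ , i≤ , j≤ = fsuc i , fsuc j , eᵢ , eⱼ , s≤s i≤ , s≤s j≤

    ∈⇒Close : ∀ {xs : List A} {a} → a ∈ xs → Close xs a a
    ∈⇒Close (here refl) = fzero , fzero , refl , refl , z≤n , z≤n
    ∈⇒Close {x ∷ xs} (there a∈) = Close-++ (x ∷ []) (∈⇒Close a∈)

    Adj⇒Close : ∀ {xs : List A} {a b} → Adj xs a b → Close xs a b
    Adj⇒Close (adj1 X Y refl) = Close-++ X (fzero , fsuc fzero , refl , refl , z≤n , s≤s z≤n)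
    Adj⇒Close (adj2 X c Y refl) = Close-++ X (fzero , fsuc (fsuc fzero) , refl , refl , z≤n , s≤s (s≤s z≤n))

    Close⇒Near : ∀ (xs : List A) {a b} → Close xs a b → a ≡ b ⊎ Near xs a b
    Close⇒Near (x ∷ xs) (fzero , fzero , refl , refl , _) = inj₁ refl
    Close⇒Near (x ∷ y ∷ xs) (fzero , fsuc fzero , refl , refl , _) = inj₂ (inj₁ (adj1 [] xs refl))
    Close⇒Near (x ∷ y ∷ z ∷ xs) (fzero , fsuc (fsuc fzero) , refl , refl , _) = inj₂ (inj₁ (adj2 [] y xs refl))
    Close⇒Near (x ∷ y ∷ z ∷ xs) (fzero , fsuc (fsuc (fsuc j)) , _ , _ , _ , s≤s (s≤s ()))
    Close⇒Near (x ∷ y ∷ xs) (fsuc fzero , fzero , refl , refl , _) = inj₂ (inj₂ (adj1 [] xs refl))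
    Close⇒Near (x ∷ y ∷ z ∷ xs) (fsuc (fsuc fzero) , fzero , refl , refl , _) = inj₂ (inj₂ (adj2 [] y xs refl))
    Close⇒Near (x ∷ y ∷ z ∷ xs) (fsuc (fsuc (fsuc i)) , fzero , _ , _ , s≤s (s≤s ()) , _)
    Close⇒Near (x ∷ xs) (fsuc i , fsuc j , eᵢ , eⱼ , s≤s i≤ , s≤s j≤) with Close⇒Near xs (i , j , eᵢ , eⱼ , i≤ , j≤)
    ... | inj₁ a≡b = inj₁ a≡b
    ... | inj₂ (inj₁ ad) = inj₂ (inj₁ (Adj-cons x ad))
    ... | inj₂ (inj₂ ad) = inj₂ (inj₂ (Adj-cons x ad))

    two-radius-by-windows : (xs : List A) → (∀ a → a ∈ xs) → (∀ a b → a ≡ b ⊎ Near xs a b) → IsTwoRadius xs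
    two-radius-by-windows xs all∈ near a b with near a b
    ... | inj₁ refl = ∈⇒Close (all∈ a)
    ... | inj₂ (inj₁ ad) = Adj⇒Close ad
    ... | inj₂ (inj₂ ad) = Close-sym {xs = xs} (Adj⇒Close ad)

    two-radius-windows : (xs : List A) → IsTwoRadius xs → ∀ a b → a ≡ b ⊎ Near xs a b
    two-radius-windows xs tr a b = Close⇒Near xs (tr a b)

  Succ-map : {A B : Set} (f : A → B) {xs : List A} {u v : A} → Succ xs u v → Succ (map f xs) (f u) (f v)
  Succ-map f (X , Y , refl) = map f X , map f Y , map-++ f X _

  Adj-map : {A B : Set} (f : A → B) {xs : List A} {a b : A} → Adj xs a b → Adj (map f xs) (f a) (f b)
  Adj-map f (adj1 X Y refl) = adj1 (map f X) (map f Y) (map-++ f X _)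
  Adj-map f (adj2 X c Y refl) = adj2 (map f X) (f c) (map f Y) (map-++ f X _)

  two-radius-map : {A B : Set} (f : A → B) (g : B → A) → (∀ b → f (g b) ≡ b) →
                   (xs : List A) → IsTwoRadius xs → IsTwoRadius (map f xs)
  two-radius-map f g fg xs tr = two-radius-by-windows (map f xs) all∈ near
    where
    all∈ : ∀ b → b ∈ map f xs
    all∈ b with tr (g b) (g b)
    ... | i , _ , eᵢ , _ = subst (_∈ map f xs) (fg b) (∈-map⁺ f (subst (_∈ xs) eᵢ (∈-lookup i)))
    near : ∀ a b → a ≡ b ⊎ Near (map f xs) a b
    near a b with two-radius-windows xs tr (g a) (g b)
    ... | inj₁ e = inj₁ (trans (sym (fg a)) (trans (cong f e) (fg b)))
    ... | inj₂ (inj₁ ad) = inj₂ (inj₁ (subst₂ (Adj (map f xs)) (fg a) (fg b) (Adj-map f ad)))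
    ... | inj₂ (inj₂ ad) = inj₂ (inj₂ (subst₂ (Adj (map f xs)) (fg b) (fg a) (Adj-map f ad)))

-- The rows x^{(j)} and the tail T of the construction are such slices, and
-- their windows are read off from the arithmetic of the indices.
module Slices {A : Set} where

  open import Data.Nat using (_∸_; s≤s)
  open import Data.Nat.Properties
  open import Data.List using ([]; _∷_; map; take; drop; _++_; applyUpTo; upTo)
  open import Data.List.Properties using (map-applyUpTo; ++-assoc)
  open import Data.Product using (Σ)
  open import Data.Nat.Tactic.RingSolver using (solve-∀)
  open import Relation.Binary.PropositionalEquality using (sym; trans; cong; cong₂; module ≡-Reasoning)
  open Windows

  slice : (ℕ → A) → ℕ → ℕ → List A
  slice f a zero = []
  slice f a (suc n) = f a ∷ slice f (suc a) n

  applyUpTo≡slice : ∀ (f g : ℕ → A) a n → (∀ i → g i ≡ f (a + i)) → applyUpTo g n ≡ slice f a n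
  applyUpTo≡slice f g a zero g≗ = refl
  applyUpTo≡slice f g a (suc n) g≗ = cong₂ _∷_ (trans (g≗ 0) (cong f (+-identityʳ a)))
    (applyUpTo≡slice f (λ i → g (suc i)) (suc a) n (λ i → trans (g≗ (suc i)) (cong f (+-suc a i))))

  map-upTo≡slice : ∀ (f : ℕ → A) n → map f (upTo n) ≡ slice f 0 n
  map-upTo≡slice f n = trans (map-applyUpTo (λ i → i) f n) (applyUpTo≡slice f f 0 n (λ i → refl))

  slice-suc : ∀ (f : ℕ → A) a n → slice (λ k → f (suc k)) a n ≡ slice f (suc a) n
  slice-suc f a zero = refl
  slice-suc f a (suc n) = cong (f (suc a) ∷_) (slice-suc f (suc a) n)

  slice-nonempty : ∀ (f : ℕ → A) a n → 0 < n → Σ (List A) λ Z → slice f a n ≡ f a ∷ Z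
  slice-nonempty f a (suc n) _ = slice f (suc a) n , refl

  length-slice : ∀ (f : ℕ → A) a n → length (slice f a n) ≡ n
  length-slice f a zero = refl
  length-slice f a (suc n) = cong suc (length-slice f (suc a) n)

  take-slice : ∀ (f : ℕ → A) a n r → r ≤ n → take r (slice f a n) ≡ slice f a r
  take-slice f a n zero _ = refl
  take-slice f a (suc n) (suc r) (s≤s r≤n) = cong (f a ∷_) (take-slice f (suc a) n r r≤n)

  drop-slice : ∀ (f : ℕ → A) a n r → r ≤ n → drop r (slice f a n) ≡ slice f (a + r) (n ∸ r)
  drop-slice f a n zero _ = cong (λ b → slice f b n) (sym (+-identityʳ a))
  drop-slice f a (suc n) (suc r) (s≤s r≤n) =
    trans (drop-slice f (suc a) n r r≤n) (cong (λ b → slice f b (n ∸ r)) (sym (+-suc a r)))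

  slice-++ : ∀ (f : ℕ → A) a k l → slice f a (k + l) ≡ slice f a k ++ slice f (a + k) l
  slice-++ f a zero l = cong (λ b → slice f b l) (sym (+-identityʳ a))
  slice-++ f a (suc k) l = cong (f a ∷_)
    (trans (slice-++ f (suc a) k l) (cong (λ b → slice f (suc a) k ++ slice f b l) (sym (+-suc a k))))

  private
    inside : ∀ {a m n} e → a ≤ m → e + m < a + n → Σ ℕ λ d → Σ ℕ λ rest →
             m ≡ a + d × n ≡ d + suc (e + rest)
    inside {a} {m} {n} e a≤m lt with m≤n⇒∃[o]m+o≡n a≤m
    ... | d , refl with m≤n⇒∃[o]m+o≡n (+-cancelˡ-≤ a (suc (e + d)) n
                          (≤-trans (≤-reflexive (solve-shift a d e)) lt))
      where
      solve-shift : ∀ a d e → a + suc (e + d) ≡ suc (e + (a + d))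
      solve-shift = solve-∀
    ...   | rest , refl = d , rest , refl , solve-inside d e rest
      where
      solve-inside : ∀ d e rest → suc (e + d) + rest ≡ d + suc (e + rest)
      solve-inside = solve-∀

  Succ-slice : ∀ (f : ℕ → A) a n m → a ≤ m → suc m < a + n → Succ (slice f a n) (f m) (f (suc m))
  Succ-slice f a n m a≤m lt with inside 1 a≤m lt
  ... | d , rest , refl , refl = slice f a d , slice f (suc (suc (a + d))) rest , slice-++ f a d (suc (suc rest))

  Adj-slice₂ : ∀ (f : ℕ → A) a n m → a ≤ m → suc (suc m) < a + n → Adj (slice f a n) (f m) (f (suc (suc m)))
  Adj-slice₂ f a n m a≤m lt with inside 2 a≤m lt
  ... | d , rest , refl , refl =
    adj2 (slice f a d) (f (suc (a + d))) (slice f (suc (suc (suc (a + d)))) rest) (slice-++ f a d (suc (suc (suc rest))))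

  private
    at-end : ∀ {a m n} e → a ≤ m → e + m ≡ a + n → Σ ℕ λ d → m ≡ a + d × n ≡ d + e
    at-end {a} {m} {n} e a≤m eq with m≤n⇒∃[o]m+o≡n a≤m
    ... | d , refl = d , refl , +-cancelˡ-≡ a n (d + e) (trans (sym eq) (shift a d e))
      where
      shift : ∀ a d e → e + (a + d) ≡ a + (d + e)
      shift = solve-∀

  Adj-slice-end₁ : ∀ (f : ℕ → A) a n m y Y → a ≤ m → suc m ≡ a + n → Adj (slice f a n ++ y ∷ Y) (f m) y
  Adj-slice-end₁ f a n m y Y a≤m eq with at-end 1 a≤m eq
  ... | d , refl , refl = adj1 (slice f a d) Y (begin
    slice f a (d + 1) ++ y ∷ Y                  ≡⟨ cong (_++ y ∷ Y) (slice-++ f a d 1) ⟩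
    (slice f a d ++ f (a + d) ∷ []) ++ y ∷ Y    ≡⟨ ++-assoc (slice f a d) _ _ ⟩
    slice f a d ++ f (a + d) ∷ y ∷ Y            ∎)
    where open ≡-Reasoning

  Adj-slice-end₂ : ∀ (f : ℕ → A) a n m y Y → a ≤ m → suc (suc m) ≡ a + n → Adj (slice f a n ++ y ∷ Y) (f m) y
  Adj-slice-end₂ f a n m y Y a≤m eq with at-end 2 a≤m eq
  ... | d , refl , refl = adj2 (slice f a d) (f (suc (a + d))) Y (begin
    slice f a (d + 2) ++ y ∷ Y                                  ≡⟨ cong (_++ y ∷ Y) (slice-++ f a d 2) ⟩
    (slice f a d ++ f (a + d) ∷ f (suc (a + d)) ∷ []) ++ y ∷ Y  ≡⟨ ++-assoc (slice f a d) _ _ ⟩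
    slice f a d ++ f (a + d) ∷ f (suc (a + d)) ∷ y ∷ Y          ∎)
    where open ≡-Reasoning

module Parity where

  open import Data.Nat.Properties using (+-suc)
  open import Data.Product using (Σ)
  open import Data.Sum using (_⊎_; inj₁; inj₂)
  open import Relation.Binary.PropositionalEquality using (sym; cong)

  parity : ∀ n → Σ ℕ λ k → n ≡ 2 * k ⊎ n ≡ suc (2 * k)
  parity zero = 0 , inj₁ refl
  parity (suc n) with parity n
  ... | k , inj₁ refl = k , inj₂ refl
  ... | k , inj₂ refl = suc k , inj₁ (cong suc (sym (+-suc k (k + 0))))

-- Linear congruences m j ≡ c (mod p) for a prime p and 0 < j < p:
-- j is invertible by Bézout's identity, which gives a solution m < p.
module Inverses (p : ℕ) (pr : Prime p) where

  open import Data.Nat using (_∸_)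
  open import Data.Nat.Properties using (*-assoc; *-identityˡ; ≤-trans; <⇒≤; <⇒≱; m+[n∸m]≡n)
  open import Data.Nat.DivMod using (_%_; m%n<n)
  open import Data.Nat.Divisibility using (∣⇒≤)
  open import Data.Nat.GCD using (module GCD; module Bézout)
  open import Data.Nat.Primality using (prime⇒irreducible)
  open import Data.Nat.Tactic.RingSolver using (solve-∀)
  open import Data.Product using (Σ)
  open import Data.Sum using (inj₁; inj₂)
  open import Relation.Nullary using (contradiction)
  open import Relation.Binary.PropositionalEquality using (sym; cong)

  instance
    p-nonZero : NonZero p
    p-nonZero = prime⇒nonZero pr

  open Modular p

  inverse : ∀ j → 0 < j → j < p → Σ ℕ λ u → u * j ≈ 1
  inverse j@(suc _) 0<j j<p with Bézout.lemma j p
  ... | Bézout.result d g identity with prime⇒irreducible pr (GCD.gcd∣n g)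
  ...   | inj₂ refl = contradiction (∣⇒≤ (GCD.gcd∣m g)) (<⇒≱ j<p)
  ...   | inj₁ refl with identity
  -- 1 + y p = x j
  ...     | Bézout.+- x y eq = x , ≈-trans (≡⇒≈ (sym eq)) (+*p 1 y)
  -- 1 + x j = y p, so x j ≡ -1 and (p - 1) x is the inverse
  ...     | Bézout.-+ x y eq = (p ∸ 1) * x , ≈-cancelʳ (p ∸ 1) (begin
    (p ∸ 1) * x * j + (p ∸ 1)      ≡⟨ distribute (p ∸ 1) x j ⟩
    (p ∸ 1) * (1 + x * j)          ≡⟨ cong ((p ∸ 1) *_) eq ⟩
    (p ∸ 1) * (y * p)              ≡⟨ *-assoc (p ∸ 1) y p ⟨
    (p ∸ 1) * y * p                ≈⟨ *p≈0 ((p ∸ 1) * y) ⟩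
    0                              ≈⟨ p≈0 ⟨
    p                              ≡⟨ m+[n∸m]≡n (≤-trans 0<j (<⇒≤ j<p)) ⟨
    1 + (p ∸ 1)                    ∎)
    where
    open ≈-Reasoning
    distribute : ∀ a x j → a * x * j + a ≡ a * (1 + x * j)
    distribute = solve-∀

  solution : ∀ j c → 0 < j → j < p → Σ ℕ λ m → m < p × m * j ≈ c
  solution j c 0<j j<p with inverse j 0<j j<p
  ... | u , uj≈1 = (u * c) % p , m%n<n (u * c) p , (begin
    (u * c) % p * j                ≈⟨ ≈-* (%≈ (u * c)) ≈-refl ⟩
    u * c * j                      ≡⟨ rearrange u c j ⟩
    u * j * c                      ≈⟨ ≈-* uj≈1 ≈-refl ⟩
    1 * c                          ≡⟨ *-identityˡ c ⟩
    c                              ∎)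
    where
    open ≈-Reasoning
    rearrange : ∀ u c j → u * c * j ≡ u * j * c
    rearrange = solve-∀

-- For an odd prime p = 2q + 1 the congruence m j ≡ c has solutions of
-- either parity below 2p: of m and m + p one is even and the other odd.
module ParitySolutions (q : ℕ) (pr : Prime (suc (2 * q))) where

  open import Data.Nat using (s≤s)
  open import Data.Nat.Properties using (≤-trans; ≤-reflexive; m≤m+n; +-monoˡ-<; +-identityʳ)
  open import Data.Nat.Tactic.RingSolver using (solve-∀)
  open import Data.Product using (Σ)
  open import Data.Sum using (_⊎_; inj₁; inj₂)
  open import Relation.Binary.PropositionalEquality using (sym; cong; subst)
  open Parity

  p : ℕ
  p = suc (2 * q)

  open Modular p
  open Inverses p pr

  parity-shift : ∀ b → b ≤ 1 → ∀ m → Σ ℕ λ k → b + 2 * k ≡ m ⊎ b + 2 * k ≡ m + p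
  parity-shift b b≤1 m with b | b≤1 | parity m
  ... | 0 | _ | k , inj₁ refl = k , inj₁ refl
  ... | 1 | _ | k , inj₂ refl = k , inj₁ refl
  ... | 0 | _ | k , inj₂ refl = suc (k + q) , inj₂ (odd+p k q)
    where
    odd+p : ∀ k q → 2 * suc (k + q) ≡ suc (2 * k) + suc (2 * q)
    odd+p = solve-∀
  ... | 1 | _ | k , inj₁ refl = k + q , inj₂ (even+p k q)
    where
    even+p : ∀ k q → suc (2 * (k + q)) ≡ 2 * k + suc (2 * q)
    even+p = solve-∀
  ... | suc (suc _) | s≤s () | _

  solution-of-parity : ∀ b → b ≤ 1 → ∀ j c → 0 < j → j < p →
                       Σ ℕ λ k → b + 2 * k < 2 * p × (b + 2 * k) * j ≈ c
  solution-of-parity b b≤1 j c 0<j j<p with solution j c 0<j j<p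
  ... | m , m<p , mj≈c with parity-shift b b≤1 m
  ...   | k , inj₁ refl = k , ≤-trans m<p (m≤m+n p (p + 0)) , mj≈c
  ...   | k , inj₂ e = k , subst (_< 2 * p) (sym e) m+p<2p ,
                        ≈-trans (≡⇒≈ (cong (_* j) e)) (≈-trans (≈-* (+p m) ≈-refl) mj≈c)
    where
    m+p<2p : m + p < 2 * p
    m+p<2p = ≤-trans (+-monoˡ-< p m<p) (≤-reflexive (cong (p +_) (sym (+-identityʳ p))))

-- After an occurrence of a letter a there are at most two
-- letters within distance 2, and the same holds before it; so a letter
-- occurring c times is close to at most 4c other letters.  In a 2-radius
-- sequence over n letters every letter is close to all n - 1 others, hence
-- n ≤ 1 + 4c for every letter, and summing the occurrence counts over the
-- alphabet bounds the length from below.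
module LowerBound where

  open import Data.Nat using (z≤n; s≤s)
  open import Data.Nat.Properties hiding (_≟_)
  open import Data.Nat.Tactic.RingSolver using (solve-∀)
  open import Data.Fin using (zero; suc)
  open import Data.Fin.Properties using (_≟_; injective⇒≤)
  open import Data.Bool using (if_then_else_)
  open import Data.List using ([]; _∷_; lookup; take; reverse; _++_)
  open import Data.List.Properties using (length-++; unfold-reverse)
  open import Data.List.Membership.Propositional using (_∈_)
  open import Data.List.Membership.Propositional.Properties using (∈-++⁺ˡ; ∈-++⁺ʳ)
  open import Data.List.Relation.Unary.Any using (here; there; index)
  open import Data.List.Relation.Unary.Any.Properties using (lookup-index)
  open import Data.Sum using (inj₁; inj₂)
  open import Algebra.Properties.CommutativeMonoid.Sum +-0-commutativeMonoid
    using (sum; ∑-distrib-+; sum-replicate-zero)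
  open import Relation.Nullary using (does; yes; no; contradiction)
  open import Relation.Binary.PropositionalEquality using (sym; trans; cong; cong₂; module ≡-Reasoning)
  open Windows

  sum-mono-≤ : ∀ {n} (f g : Fin n → ℕ) → (∀ a → f a ≤ g a) → sum f ≤ sum g
  sum-mono-≤ {zero} f g f≤g = z≤n
  sum-mono-≤ {suc n} f g f≤g =
    +-mono-≤ (f≤g zero) (sum-mono-≤ (λ i → f (suc i)) (λ i → g (suc i)) (λ i → f≤g (suc i)))

  sum-const : ∀ n c → sum {n} (λ _ → c) ≡ n * c
  sum-const zero c = refl
  sum-const (suc n) c = cong (c +_) (sum-const n c)

  module _ {n : ℕ} where

    indicator : Fin n → Fin n → ℕ
    indicator u a = if does (u ≟ a) then 1 else 0

    occurrences : Fin n → List (Fin n) → ℕ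
    occurrences a [] = 0
    occurrences a (u ∷ xs) = indicator u a + occurrences a xs

    successors : Fin n → List (Fin n) → List (Fin n)
    successors a [] = []
    successors a (u ∷ xs) = (if does (u ≟ a) then take 2 xs else []) ++ successors a xs

    length-take2 : ∀ (xs : List (Fin n)) → length (take 2 xs) ≤ 2
    length-take2 [] = z≤n
    length-take2 (x ∷ []) = s≤s z≤n
    length-take2 (x ∷ y ∷ xs) = ≤-refl

    length-successors : ∀ a xs → length (successors a xs) ≤ 2 * occurrences a xs
    length-successors a [] = z≤n
    length-successors a (u ∷ xs) with u ≟ a
    ... | yes _ = begin
      length (take 2 xs ++ successors a xs)               ≡⟨ length-++ (take 2 xs) ⟩
      length (take 2 xs) + length (successors a xs)       ≤⟨ +-mono-≤ (length-take2 xs) (length-successors a xs) ⟩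
      2 + 2 * occurrences a xs                            ≡⟨ *-distribˡ-+ 2 1 (occurrences a xs) ⟨
      2 * (1 + occurrences a xs)                          ∎
      where open ≤-Reasoning
    ... | no _ = length-successors a xs

    successors-after : ∀ {a b} (X c : List (Fin n)) → b ∈ take 2 c → b ∈ successors a (X ++ a ∷ c)
    successors-after {a} [] c b∈ with a ≟ a
    ... | yes _ = ∈-++⁺ˡ b∈
    ... | no a≢a = contradiction refl a≢a
    successors-after (x ∷ X) c b∈ = ∈-++⁺ʳ _ (successors-after X c b∈)

    Adj⇒∈successors : ∀ {xs a b} → Adj xs a b → b ∈ successors a xs
    Adj⇒∈successors (adj1 X Y refl) = successors-after X (_ ∷ Y) (here refl)
    Adj⇒∈successors (adj2 X c Y refl) = successors-after X (c ∷ _ ∷ Y) (there (here refl))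

    occurrences-++ : ∀ a xs ys → occurrences a (xs ++ ys) ≡ occurrences a xs + occurrences a ys
    occurrences-++ a [] ys = refl
    occurrences-++ a (x ∷ xs) ys =
      trans (cong (indicator x a +_) (occurrences-++ a xs ys)) (sym (+-assoc (indicator x a) _ _))

    occurrences-reverse : ∀ a xs → occurrences a (reverse xs) ≡ occurrences a xs
    occurrences-reverse a [] = refl
    occurrences-reverse a (x ∷ xs) = begin
      occurrences a (reverse (x ∷ xs))                        ≡⟨ cong (occurrences a) (unfold-reverse x xs) ⟩
      occurrences a (reverse xs ++ x ∷ [])                    ≡⟨ occurrences-++ a (reverse xs) (x ∷ []) ⟩
      occurrences a (reverse xs) + (indicator x a + 0)        ≡⟨ cong₂ _+_ (occurrences-reverse a xs) (+-identityʳ _) ⟩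
      occurrences a xs + indicator x a                        ≡⟨ +-comm (occurrences a xs) (indicator x a) ⟩
      indicator x a + occurrences a xs                        ∎
      where open ≡-Reasoning

    exhaustive⇒≤length : (L : List (Fin n)) → (∀ b → b ∈ L) → n ≤ length L
    exhaustive⇒≤length L all∈ = injective⇒≤ {f = λ b → index (all∈ b)} λ {x} {y} e →
      trans (lookup-index (all∈ x)) (trans (cong (lookup L) e) (sym (lookup-index (all∈ y))))

    occurrence-bound : ∀ xs → IsTwoRadius xs → ∀ a → n ≤ 1 + 4 * occurrences a xs
    occurrence-bound xs tr a = begin
      n                                                       ≤⟨ exhaustive⇒≤length L all∈ ⟩
      length L                                                ≡⟨ cong suc (length-++ (successors a xs)) ⟩
      1 + (length (successors a xs) + length (successors a (reverse xs)))
        ≤⟨ s≤s (+-mono-≤ (length-successors a xs) (length-successors a (reverse xs))) ⟩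
      1 + (2 * occurrences a xs + 2 * occurrences a (reverse xs))
        ≡⟨ cong (λ c → 1 + (2 * occurrences a xs + 2 * c)) (occurrences-reverse a xs) ⟩
      1 + (2 * occurrences a xs + 2 * occurrences a xs)       ≡⟨ cong suc (*-distribʳ-+ (occurrences a xs) 2 2) ⟨
      1 + 4 * occurrences a xs                                ∎
      where
      open ≤-Reasoning
      L : List (Fin n)
      L = a ∷ (successors a xs ++ successors a (reverse xs))
      all∈ : ∀ b → b ∈ L
      all∈ b with two-radius-windows xs tr a b
      ... | inj₁ refl = here refl
      ... | inj₂ (inj₁ ad) = there (∈-++⁺ˡ (Adj⇒∈successors ad))
      ... | inj₂ (inj₂ ad) = there (∈-++⁺ʳ _ (Adj⇒∈successors (Adj-reverse ad)))

  indicator-sum : ∀ {n} (u : Fin n) → sum (indicator u) ≡ 1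
  indicator-sum {suc n} zero = cong suc (sum-replicate-zero n)
  indicator-sum {suc n} (suc u) = indicator-sum u

  length≡sum-occurrences : ∀ {n} (xs : List (Fin n)) → length xs ≡ sum (λ a → occurrences a xs)
  length≡sum-occurrences {n} [] = sym (sum-replicate-zero n)
  length≡sum-occurrences (u ∷ xs) = begin
    suc (length xs)                                            ≡⟨ cong suc (length≡sum-occurrences xs) ⟩
    1 + sum (λ a → occurrences a xs)                           ≡⟨ cong (_+ _) (indicator-sum u) ⟨
    sum (indicator u) + sum (λ a → occurrences a xs)           ≡⟨ ∑-distrib-+ (indicator u) (λ a → occurrences a xs) ⟨
    sum (λ a → indicator u a + occurrences a xs)               ∎
    where open ≡-Reasoning

  length-bound : ∀ {n} c (xs : List (Fin n)) → (∀ a → c ≤ occurrences a xs) → n * c ≤ length xs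
  length-bound {n} c xs c≤ = begin
    n * c                                  ≡⟨ sum-const n c ⟨
    sum {n} (λ _ → c)                      ≤⟨ sum-mono-≤ _ _ c≤ ⟩
    sum (λ a → occurrences a xs)           ≡⟨ length≡sum-occurrences xs ⟨
    length xs                              ∎
    where open ≤-Reasoning

  -- for n = 2p with p = 2q + 1 every letter occurs at least q + 1 times
  two-radius-lower-bound : ∀ q (xs : List (Fin (2 * suc (2 * q)))) → IsTwoRadius xs →
                           suc (2 * q) * suc (2 * q) + suc (2 * q) ≤ length xs
  two-radius-lower-bound q xs tr = begin
    suc (2 * q) * suc (2 * q) + suc (2 * q)   ≡⟨ p²+p≡2p[q+1] q ⟩
    2 * suc (2 * q) * suc q                   ≤⟨ length-bound (suc q) xs often ⟩
    length xs                                 ∎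
    where
    open ≤-Reasoning
    p²+p≡2p[q+1] : ∀ q → suc (2 * q) * suc (2 * q) + suc (2 * q) ≡ 2 * suc (2 * q) * suc q
    p²+p≡2p[q+1] = solve-∀
    often : ∀ a → suc q ≤ occurrences a xs
    often a = *-cancelˡ-< 4 q (occurrences a xs)
      (≤-pred (≤-trans (≤-reflexive (2p≡ q)) (occurrence-bound xs tr a)))
      where
      2p≡ : ∀ q → suc (suc (4 * q)) ≡ 2 * suc (2 * q)
      2p≡ = solve-∀

-- The shape of IT′ for p = 2q + 1 (q ≥ 1): the rows x^{(j)} and the tail T
-- are slices, and IT′ is the concatenation of the blocks
--   J 1, …, J q, Ĵ q, …, Ĵ 1, T′,
-- in which we locate the pairs of consecutive blocks.
module Layout (q : ℕ) (q≥1 : 1 ≤ q) where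

  open import Data.Nat using (_∸_; _/_; _%_; _≡ᵇ_; s≤s)
  open import Data.Nat.Properties
  open import Data.Nat.DivMod using (m*n/n≡m; m*n%n≡0; [m+kn]%n≡m%n)
  open import Data.Bool using (true; false; not)
  open import Data.Bool.Properties using (not-involutive)
  open import Data.Sum using (inj₁; inj₂)
  open import Data.List using ([]; _∷_; map; take; drop; _++_; concat; reverse)
  open import Data.List.Properties using (++-assoc; ++-identityʳ; concat-++; map-++; reverse-++; unfold-reverse)
  open import Data.Product using (Σ)
  open import Data.Nat.Tactic.RingSolver using (solve-∀)
  open import Relation.Binary.PropositionalEquality hiding (J)
  open Windows
  open Slices
  open Parity

  p : ℕ
  p = suc (2 * q)

  open Construction p public renaming (IT′ to IT′ₚ)

  h≡q : h ≡ q
  h≡q = trans (cong (_/ 2) (*-comm 2 q)) (m*n/n≡m q 2)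

  2p≡4q+2 : 2 * p ≡ suc (suc (4 * q))
  2p≡4q+2 = lemma q
    where
    lemma : ∀ q → 2 * suc (2 * q) ≡ suc (suc (4 * q))
    lemma = solve-∀

  even-double : ∀ k → even (2 * k) ≡ true
  even-double k = cong (_≡ᵇ 0) (trans (cong (_% 2) (*-comm 2 k)) (m*n%n≡0 k 2))

  even-odd : ∀ k → even (suc (2 * k)) ≡ false
  even-odd k = cong (_≡ᵇ 0) (trans (cong (λ n → suc n % 2) (*-comm 2 k)) ([m+kn]%n≡m%n 1 k 2))

  x-even : ∀ j k → x j (2 * k) ≡ inj₁ (pos (2 * k * j))
  x-even j k rewrite even-double k = refl

  x-odd : ∀ j k → x j (suc (2 * k)) ≡ inj₂ (pos (suc (2 * k) * j))
  x-odd j k rewrite even-odd k = refl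

  double-suc : ∀ k → suc (suc (2 * k)) ≡ 2 * suc k
  double-suc = solve-∀

  even-suc : ∀ j → even (suc j) ≡ not (even j)
  even-suc j with parity j
  ... | k , inj₁ refl = trans (even-odd k) (sym (cong not (even-double k)))
  ... | k , inj₂ refl = trans (cong even (double-suc k)) (trans (even-double (suc k)) (sym (cong not (even-odd k))))

  even-succ : ∀ j {b} → even j ≡ b → even (suc j) ≡ not b
  even-succ j e = trans (even-suc j) (cong not e)

  even-pred : ∀ j {b} → even (suc j) ≡ b → even j ≡ not b
  even-pred j e = trans (sym (not-involutive (even j))) (cong not (trans (sym (even-suc j)) e))

  J-odd : ∀ {j} → even j ≡ false → J j ≡ I′ j
  J-odd e rewrite e = refl

  J-even : ∀ {j} → even j ≡ true → J j ≡ I″ j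
  J-even e rewrite e = refl

  Ĵ-odd : ∀ {j} → even j ≡ false → Ĵ j ≡ I″ j
  Ĵ-odd e rewrite e = refl

  Ĵ-even : ∀ {j} → even j ≡ true → Ĵ j ≡ I′ j
  Ĵ-even e rewrite e = refl

  row≡slice : ∀ j → row j ≡ slice (x j) 0 (2 * p)
  row≡slice j = map-upTo≡slice (x j) (2 * p)

  I′≡slice : ∀ j → r j ≤ 2 * p → I′ j ≡ slice (x j) 0 (r j)
  I′≡slice j r≤2p = trans (cong (take (r j)) (row≡slice j)) (take-slice (x j) 0 (2 * p) (r j) r≤2p)

  I″≡slice : ∀ j → r j ≤ 2 * p → I″ j ≡ slice (x j) (r j) (2 * p ∸ r j)
  I″≡slice j r≤2p = trans (cong (drop (r j)) (row≡slice j)) (drop-slice (x j) 0 (2 * p) (r j) r≤2p)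

  T′≡ : T′ ≡ t 2 ∷ t 1 ∷ slice t 3 (4 * q)
  T′≡ = cong swap12 (trans (map-upTo≡slice (λ k → t (suc k)) (2 * p))
          (trans (slice-suc t 0 (2 * p)) (cong (slice t 1) 2p≡4q+2)))

  blocks : List (List Alph)
  blocks = map J js ++ map Ĵ (reverse js) ++ T′ ∷ []

  IT′≡concat-blocks : IT′ₚ ≡ concat blocks
  IT′≡concat-blocks = begin
    (concat (map J js) ++ concat (map Ĵ (reverse js))) ++ T′
      ≡⟨ ++-assoc (concat (map J js)) _ _ ⟩
    concat (map J js) ++ concat (map Ĵ (reverse js)) ++ T′
      ≡⟨ cong (λ l → concat (map J js) ++ concat (map Ĵ (reverse js)) ++ l) (++-identityʳ T′) ⟨
    concat (map J js) ++ concat (map Ĵ (reverse js)) ++ concat (T′ ∷ [])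
      ≡⟨ cong (concat (map J js) ++_) (concat-++ (map Ĵ (reverse js)) (T′ ∷ [])) ⟩
    concat (map J js) ++ concat (map Ĵ (reverse js) ++ T′ ∷ [])
      ≡⟨ concat-++ (map J js) _ ⟩
    concat blocks ∎
    where open ≡-Reasoning

  Factor : List Alph → Set
  Factor L = Σ (List Alph) λ X → Σ (List Alph) λ Y → IT′ₚ ≡ X ++ L ++ Y

  Factor-Adj : ∀ {L a b} → Factor L → Adj L a b → Adj IT′ₚ a b
  Factor-Adj (X , Y , e) ad = subst (λ l → Adj l _ _) (sym e) (Adj-infix X Y ad)

  Succ-blocks⇒Factor : ∀ {P Q} → Succ blocks P Q → Factor (P ++ Q)
  Succ-blocks⇒Factor {P} {Q} (Bs , Cs , e) = concat Bs , concat Cs , (begin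
    IT′ₚ                                  ≡⟨ IT′≡concat-blocks ⟩
    concat blocks                         ≡⟨ cong concat e ⟩
    concat (Bs ++ P ∷ Q ∷ Cs)             ≡⟨ concat-++ Bs (P ∷ Q ∷ Cs) ⟨
    concat Bs ++ P ++ Q ++ concat Cs      ≡⟨ cong (concat Bs ++_) (++-assoc P Q (concat Cs)) ⟨
    concat Bs ++ (P ++ Q) ++ concat Cs    ∎)
    where open ≡-Reasoning

  js≡slice : js ≡ slice (λ i → i) 1 q
  js≡slice = trans (map-upTo≡slice suc h) (trans (slice-suc (λ i → i) 0 h) (cong (slice (λ i → i) 1) h≡q))

  js-last : Σ (List ℕ) λ X → js ≡ X ++ q ∷ []
  js-last with m≤n⇒∃[o]m+o≡n q≥1
  ... | l , refl = slice (λ i → i) 1 l ,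
    trans js≡slice (trans (cong (slice (λ i → i) 1) (+-comm 1 l)) (slice-++ (λ i → i) 1 l 1))

  js-first : Σ (List ℕ) λ Y → js ≡ 1 ∷ Y
  js-first with m≤n⇒∃[o]m+o≡n q≥1
  ... | l , refl = slice (λ i → i) 2 l , js≡slice

  js-succ : ∀ j → 1 ≤ j → j < q → Succ js j (suc j)
  js-succ j 1≤j j<q = subst (λ l → Succ l j (suc j)) (sym js≡slice) (Succ-slice (λ i → i) 1 q j 1≤j (s≤s j<q))

  Succ-J : ∀ j → 1 ≤ j → j < q → Succ blocks (J j) (J (suc j))
  Succ-J j 1≤j j<q = Succ-++ˡ _ (Succ-map J (js-succ j 1≤j j<q))

  Succ-Ĵ : ∀ j → 1 ≤ j → j < q → Succ blocks (Ĵ (suc j)) (Ĵ j)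
  Succ-Ĵ j 1≤j j<q = Succ-++ʳ (map J js) (Succ-++ˡ _ (Succ-map Ĵ (Succ-reverse (js-succ j 1≤j j<q))))

  Succ-JĴ : Succ blocks (J q) (Ĵ q)
  Succ-JĴ with js-last
  ... | X , e = Succ-junction (trans (cong (map J) e) (map-++ J X (q ∷ [])))
                  (cong (λ l → map Ĵ l ++ T′ ∷ []) (trans (cong reverse e) (reverse-++ X (q ∷ []))))

  Succ-ĴT : Succ blocks (Ĵ 1) T′
  Succ-ĴT with js-first
  ... | Y , e = Succ-++ʳ (map J js) (Succ-junction
                  (trans (cong (λ l → map Ĵ (reverse l)) e)
                    (trans (cong (map Ĵ) (unfold-reverse 1 Y)) (map-++ Ĵ (reverse Y) (1 ∷ [])))) refl)

-- For 1 ≤ j ≤ q the cut point r_j is odd,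
-- r_j j ≡ 1 (mod p), and r_j < 2p; hence x^{(j)}_{r_j} = 1̲, and I′ j, which
-- ends just before that entry, is followed in IT′ by a factor starting with
-- 1̲, while I″ j, which ends at index 2p - 1, is followed by one starting
-- with 0 = x^{(j)}_{2p}.  So each row continues cyclically across the cut.
module Rows (q : ℕ) (pr : Prime (suc (2 * q))) (q≥1 : 1 ≤ q) where

  open import Data.Nat using (_∸_; _%_; _≡ᵇ_; z≤n; s≤s)
  open import Data.Nat.Properties hiding (_≟_)
  open import Data.Nat.DivMod using (m*n%n≡0; [m+kn]%n≡m%n)
  open import Data.Bool using (Bool; true; false; _∧_)
  open import Data.Bool.Properties using (T-≡; T-∧)
  open import Data.List using (_∷_; map; upTo; _++_)
  open import Data.List.Membership.Propositional using (_∈_)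
  open import Data.List.Membership.Propositional.Properties using (∈-map⁺; ∈-map⁻; ∈-upTo⁺; ∈-upTo⁻)
  open import Data.List.Relation.Unary.Any using (here; there)
  open import Data.Product using (Σ)
  open import Data.Sum using (inj₁; inj₂)
  open import Function.Bundles using (Equivalence)
  open import Relation.Nullary using (contradiction)
  open import Relation.Binary.PropositionalEquality hiding (J)
  open Windows
  open Slices
  open Parity
  open Layout q q≥1
  open Modular p
  open ParitySolutions q pr using (solution-of-parity)

  q<p : q < p
  q<p = s≤s (m≤m+n q (q + 0))

  found : ℕ → ℕ → Bool
  found j s = (s % 2 ≡ᵇ 1) ∧ ((s * j) % p ≡ᵇ 1 % p)

  found⇒ : ∀ j s → found j s ≡ true → s % 2 ≡ 1 × s * j ≈ 1
  found⇒ j s e with Equivalence.to T-∧ (Equivalence.from T-≡ e)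
  ... | odd , inv = ≡ᵇ⇒≡ _ _ odd , ≈i (≡ᵇ⇒≡ _ _ inv)

  ⇒found : ∀ j s → s % 2 ≡ 1 → s * j ≈ 1 → found j s ≡ true
  ⇒found j s odd inv = Equivalence.to T-≡ (Equivalence.from T-∧ (≡⇒≡ᵇ _ _ odd , ≡⇒≡ᵇ _ _ (residue inv)))

  search-finds : ∀ j L m → m ∈ L → found j m ≡ true → search j L ∈ L × found j (search j L) ≡ true
  search-finds j (s ∷ L) m m∈ fm with found j s in fs
  ... | true = here refl , fs
  ... | false with m∈
  ...   | here refl = contradiction (trans (sym fs) fm) λ ()
  ...   | there m∈L with search-finds j L m m∈L fm
  ...     | ∈L , f = there ∈L , f

  record OddInverse (j : ℕ) : Set where
    field
      s : ℕ
      r≡ : r j ≡ suc (2 * s)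
      r<2p : suc (2 * s) < 2 * p
      inverse : suc (2 * s) * j ≈ 1

  -- kept opaque: unfolding search on a symbolic alphabet is costly and never needed
  opaque
    r-spec : ∀ j → 1 ≤ j → j ≤ q → OddInverse j
    r-spec j 1≤j j≤q with solution-of-parity 1 (s≤s z≤n) j 1 1≤j (≤-<-trans j≤q q<p)
    ... | k , k<2p , inv with search-finds j (map suc (upTo (2 * p ∸ 1))) (suc (2 * k))
                                (∈-map⁺ suc (∈-upTo⁺ (≤-pred k<2p))) (⇒found j (suc (2 * k)) (odd-mod k) inv)
      where
      odd-mod : ∀ k → suc (2 * k) % 2 ≡ 1
      odd-mod k = trans (cong (λ n → suc n % 2) (*-comm 2 k)) ([m+kn]%n≡m%n 1 k 2)
    ... | r∈ , fr with ∈-map⁻ suc r∈ | found⇒ j (r j) fr | parity (r j)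
    ...   | _ , _ , _ | odd , _ | s , inj₁ even = contradiction (trans (sym (even-mod s even)) odd) λ ()
      where
      even-mod : ∀ s → r j ≡ 2 * s → r j % 2 ≡ 0
      even-mod s e = trans (cong (_% 2) (trans e (*-comm 2 s))) (m*n%n≡0 s 2)
    ...   | i , i∈ , r≡suc-i | _ , inv′ | s , inj₂ r≡ = record
      { s = s ; r≡ = r≡
      ; r<2p = subst (_< 2 * p) (trans (sym r≡suc-i) r≡) (s≤s (∈-upTo⁻ i∈))
      ; inverse = subst (λ n → n * j ≈ 1) r≡ inv′ }

  r≤2p : ∀ j → 1 ≤ j → j ≤ q → r j ≤ 2 * p
  r≤2p j 1≤j j≤q = ≤-trans (≤-reflexive r≡) (<⇒≤ r<2p)
    where open OddInverse (r-spec j 1≤j j≤q)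

  I′-head : ∀ j → 1 ≤ j → j ≤ q → Σ (List Alph) λ Z → I′ j ≡ inj₁ (pos 0) ∷ Z
  I′-head j 1≤j j≤q = slice (x j) 1 (2 * s) , trans (I′≡slice j (r≤2p j 1≤j j≤q)) (cong (slice (x j) 0) r≡)
    where open OddInverse (r-spec j 1≤j j≤q)

  I″-head : ∀ j → 1 ≤ j → j ≤ q → Σ (List Alph) λ Z → I″ j ≡ inj₂ (pos 1) ∷ Z
  I″-head j 1≤j j≤q with slice-nonempty (x j) (r j) (2 * p ∸ r j) (m<n⇒0<n∸m (subst (_< 2 * p) (sym r≡) r<2p))
    where open OddInverse (r-spec j 1≤j j≤q)
  ... | Z , e = Z , trans (I″≡slice j (r≤2p j 1≤j j≤q)) (trans e (cong (_∷ Z) (begin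
    x j (r j)                        ≡⟨ cong (x j) r≡ ⟩
    x j (suc (2 * s))                ≡⟨ x-odd j s ⟩
    inj₂ (pos (suc (2 * s) * j))     ≡⟨ cong inj₂ (pos-≈ inverse) ⟩
    inj₂ (pos 1)                     ∎)))
    where
    open OddInverse (r-spec j 1≤j j≤q)
    open ≡-Reasoning

  T′-head : Σ (List Alph) λ Z → T′ ≡ inj₁ (pos 0) ∷ Z
  T′-head = t 1 ∷ slice t 3 (4 * q) ,
    trans T′≡ (cong (λ c → inj₁ c ∷ t 1 ∷ slice t 3 (4 * q)) (neg-≈ 0 {0} ≈-refl))

  followed-by : ∀ {P Q P′ y Z} → Succ blocks P Q → P ≡ P′ → Q ≡ y ∷ Z → Factor (P′ ++ y ∷ Z)
  followed-by succ refl refl = Succ-blocks⇒Factor succ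

  I′-followed : ∀ j → 1 ≤ j → j ≤ q → Σ (List Alph) λ Z → Factor (I′ j ++ inj₂ (pos 1) ∷ Z)
  I′-followed (suc i) _ j≤q with even (suc i) in e | m≤n⇒m<n∨m≡n j≤q
  -- j odd, j < q: the next block is J (j + 1) = I″ (j + 1)
  ... | false | inj₁ j<q = let Z , h = I″-head (suc (suc i)) (s≤s z≤n) j<q in
    Z , followed-by (Succ-J (suc i) (s≤s z≤n) j<q) (J-odd e) (trans (J-even (even-succ (suc i) e)) h)
  -- j odd, j = q: the next block is Ĵ q = I″ q
  ... | false | inj₂ j≡q = let Z , h = I″-head (suc i) (s≤s z≤n) j≤q in
    Z , followed-by (subst (λ l → Succ blocks (J l) (Ĵ l)) (sym j≡q) Succ-JĴ) (J-odd e) (trans (Ĵ-odd e) h)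
  -- j even: the next block is Ĵ (j - 1) = I″ (j - 1), as j - 1 is odd
  I′-followed (suc zero) _ _ | true | _ with () ← e
  I′-followed (suc (suc i)) _ j≤q | true | _ = let Z , h = I″-head (suc i) (s≤s z≤n) (<⇒≤ j≤q) in
    Z , followed-by (Succ-Ĵ (suc i) (s≤s z≤n) j≤q) (Ĵ-even e) (trans (Ĵ-odd (even-pred (suc i) e)) h)

  I″-followed : ∀ j → 1 ≤ j → j ≤ q → Σ (List Alph) λ Z → Factor (I″ j ++ inj₁ (pos 0) ∷ Z)
  I″-followed (suc i) _ j≤q with even (suc i) in e | m≤n⇒m<n∨m≡n j≤q
  -- j even, j < q: the next block is J (j + 1) = I′ (j + 1)
  ... | true | inj₁ j<q = let Z , h = I′-head (suc (suc i)) (s≤s z≤n) j<q in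
    Z , followed-by (Succ-J (suc i) (s≤s z≤n) j<q) (J-even e) (trans (J-odd (even-succ (suc i) e)) h)
  -- j even, j = q: the next block is Ĵ q = I′ q
  ... | true | inj₂ j≡q = let Z , h = I′-head (suc i) (s≤s z≤n) j≤q in
    Z , followed-by (subst (λ l → Succ blocks (J l) (Ĵ l)) (sym j≡q) Succ-JĴ) (J-even e) (trans (Ĵ-even e) h)
  -- j = 1: the next block is T′
  I″-followed (suc zero) _ _ | false | _ = let Z , h = T′-head in Z , followed-by Succ-ĴT refl h
  -- j odd, j > 1: the next block is Ĵ (j - 1) = I′ (j - 1), as j - 1 is even
  I″-followed (suc (suc i)) _ j≤q | false | _ = let Z , h = I′-head (suc i) (s≤s z≤n) (<⇒≤ j≤q) in
    Z , followed-by (Succ-Ĵ (suc i) (s≤s z≤n) j≤q) (Ĵ-odd e) (trans (Ĵ-even (even-pred (suc i) e)) h)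

-- Its entries are, for k = 0, 1, …,
--   t_{4k+1} = -2k̲,  t_{4k+2} = -2k,  t_{4k+3} = 2k+2,  t_{4k+4} = 2k+2̲,
-- and consecutive entries of T′ are near each other.  Hence T′ supplies the
-- pairs {c, c̲} for every c, and the pairs {1 - j, 1 + j} and {-j̲, j̲} for
-- 1 ≤ j ≤ q, which the rows miss around their cut points.
module Tail (q : ℕ) (q≥1 : 1 ≤ q) where

  open import Data.Nat using (_/_; _%_; z≤n; s≤s)
  open import Data.Nat.Properties hiding (_≟_)
  open import Data.Nat.DivMod using (m*n/n≡m; [m+kn]%n≡m%n)
  open import Data.Nat.Tactic.RingSolver using (solve-∀)
  open import Data.Fin using (toℕ)
  open import Data.Fin.Properties using (toℕ<n)
  open import Data.List using ([]; _∷_; _++_)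
  open import Data.List.Properties using (++-identityʳ)
  open import Data.Product using (Σ)
  open import Data.Sum using (_⊎_; inj₁; inj₂)
  open import Relation.Nullary using (contradiction)
  open import Relation.Binary.PropositionalEquality hiding (J)
  open Windows
  open Slices
  open Parity
  open Layout q q≥1
  open Modular p

  private
    quarter : ∀ k → 4 * k / 2 ≡ 2 * k
    quarter k = trans (cong (_/ 2) (four k)) (m*n/n≡m (2 * k) 2)
      where
      four : ∀ k → 4 * k ≡ 2 * k * 2
      four = solve-∀

    mod4 : ∀ d k → (d + 4 * k) % 4 ≡ d % 4
    mod4 d k = trans (cong (λ n → (d + n) % 4) (*-comm 4 k)) ([m+kn]%n≡m%n d k 4)

  t-value₁ : ∀ k → t (1 + 4 * k) ≡ inj₂ (neg (2 * k))
  t-value₁ k with (1 + 4 * k) % 4 | mod4 1 k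
  ... | .1 | refl = cong (λ n → inj₂ (neg n)) (quarter k)

  t-value₂ : ∀ k → t (2 + 4 * k) ≡ inj₁ (neg (2 * k))
  t-value₂ k with (2 + 4 * k) % 4 | mod4 2 k
  ... | .2 | refl = cong (λ n → inj₁ (neg n)) (quarter k)

  t-value₃ : ∀ k → t (3 + 4 * k) ≡ inj₁ (pos (2 + 2 * k))
  t-value₃ k with (3 + 4 * k) % 4 | mod4 3 k
  ... | .3 | refl = cong (λ n → inj₁ (pos n)) (trans (cong (_/ 2) (double k)) (m*n/n≡m (2 + 2 * k) 2))
    where
    double : ∀ k → 3 + 4 * k + 1 ≡ (2 + 2 * k) * 2
    double = solve-∀

  t-value₄ : ∀ k → t (4 + 4 * k) ≡ inj₂ (pos (2 + 2 * k))
  t-value₄ k with (4 + 4 * k) % 4 | trans (cong (_% 4) (multiple k)) ([m+kn]%n≡m%n 0 (suc k) 4)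
    where
    multiple : ∀ k → 4 + 4 * k ≡ 0 + suc k * 4
    multiple = solve-∀
  ... | .0 | refl = cong (λ n → inj₂ (pos n)) (trans (cong (_/ 2) (double k)) (m*n/n≡m (2 + 2 * k) 2))
    where
    double : ∀ k → 4 + 4 * k ≡ (2 + 2 * k) * 2
    double = solve-∀

  Near-t : ∀ i → 1 ≤ i → i ≤ suc (4 * q) → Near T′ (t i) (t (suc i))
  Near-t 1 _ _ = inj₂ (subst (λ l → Adj l (t 2) (t 1)) (sym T′≡) (adj1 [] (slice t 3 (4 * q)) refl))
  Near-t 2 _ _ with slice-nonempty t 3 (4 * q) (≤-trans (s≤s z≤n) (*-monoʳ-≤ 4 q≥1))
  ... | Z , e = inj₁ (subst (λ l → Adj l (t 2) (t 3)) (sym (trans T′≡ (cong (λ l → t 2 ∷ t 1 ∷ l) e)))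
                    (adj2 [] (t 1) Z refl))
  Near-t (suc (suc (suc i))) _ i≤ = inj₁ (subst (λ l → Adj l (t (3 + i)) (t (4 + i))) (sym T′≡)
    (Adj-cons (t 2) (Adj-cons (t 1) (Succ⇒Adj (Succ-slice t 3 (4 * q) (3 + i) (s≤s (s≤s (s≤s z≤n))) (s≤s (s≤s i≤)))))))

  private
    inside : ∀ {k} d → d ≤ 5 → k < q → d + 4 * k ≤ suc (4 * q)
    inside {k} d d≤5 k<q = ≤-trans (+-monoˡ-≤ (4 * k) d≤5) (≤-trans (≤-reflexive (five k)) (s≤s (*-monoʳ-≤ 4 k<q)))
      where
      five : ∀ k → 5 + 4 * k ≡ suc (4 * suc k)
      five = solve-∀

  T′-minus : ∀ k → k ≤ q → Near T′ (inj₂ (neg (2 * k))) (inj₁ (neg (2 * k)))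
  T′-minus k k≤q = subst₂ (Near T′) (t-value₁ k) (t-value₂ k)
    (Near-t (1 + 4 * k) (s≤s z≤n) (s≤s (*-monoʳ-≤ 4 k≤q)))

  T′-cross : ∀ k → k < q → Near T′ (inj₁ (neg (2 * k))) (inj₁ (pos (2 + 2 * k)))
  T′-cross k k<q = subst₂ (Near T′) (t-value₂ k) (t-value₃ k)
    (Near-t (2 + 4 * k) (s≤s z≤n) (inside 2 (s≤s (s≤s z≤n)) k<q))

  T′-plus : ∀ k → k < q → Near T′ (inj₁ (pos (2 + 2 * k))) (inj₂ (pos (2 + 2 * k)))
  T′-plus k k<q = subst₂ (Near T′) (t-value₃ k) (t-value₄ k)
    (Near-t (3 + 4 * k) (s≤s z≤n) (inside 3 (s≤s (s≤s (s≤s z≤n))) k<q))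

  T′-wrap : ∀ k → k < q → Near T′ (inj₂ (pos (2 + 2 * k))) (inj₂ (neg (2 * suc k)))
  T′-wrap k k<q = subst₂ (Near T′) (t-value₄ k) (trans (cong t (five k)) (t-value₁ (suc k)))
    (Near-t (4 + 4 * k) (s≤s z≤n) (inside 4 (s≤s (s≤s (s≤s (s≤s z≤n)))) k<q))
    where
    five : ∀ k → 5 + 4 * k ≡ 1 + 4 * suc k
    five = solve-∀

  T′-factor : Factor T′
  T′-factor = I , [] , cong (I ++_) (sym (++-identityʳ T′))

  Near-T′⇒Near : ∀ {a b} → Near T′ a b → Near IT′ₚ a b
  Near-T′⇒Near (inj₁ ad) = inj₁ (Factor-Adj T′-factor ad)
  Near-T′⇒Near (inj₂ ad) = inj₂ (Factor-Adj T′-factor ad)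

  private
    odd-split : ∀ k k′ → k + k′ ≡ q → 2 * k′ + suc (2 * k) ≡ p
    odd-split k k′ e = trans (lemma k k′) (cong (λ n → suc (2 * n)) e)
      where
      lemma : ∀ k k′ → 2 * k′ + suc (2 * k) ≡ suc (2 * (k + k′))
      lemma = solve-∀

    even-split : ∀ k k′ → k + k′ ≡ q → 2 + 2 * k′ + 2 * k ≡ suc p
    even-split k k′ e = trans (lemma k k′) (cong (λ n → suc (suc (2 * n))) e)
      where
      lemma : ∀ k k′ → 2 + 2 * k′ + 2 * k ≡ suc (suc (2 * (k + k′)))
      lemma = solve-∀

    complement : ∀ {k} → k ≤ q → Σ ℕ λ k′ → k + k′ ≡ q
    complement k≤q = m≤n⇒∃[o]m+o≡n k≤q

    odd≤q⇒<q : ∀ {k} → suc (2 * k) ≤ q → k < q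
    odd≤q⇒<q {k} le = ≤-trans (s≤s (m≤m+n k (k + 0))) le

  residue-shape : ∀ (c : Fin p) →
    (Σ ℕ λ k → k < q × pos (2 + 2 * k) ≡ c) ⊎ (Σ ℕ λ k → k ≤ q × neg (2 * k) ≡ c)
  residue-shape c with parity (toℕ c) | toℕ<n c
  ... | zero , inj₁ c≡0 | _ = inj₂ (0 , z≤n , trans (neg-≈ 0 (≡⇒≈ c≡0)) (pos-toℕ c))
  ... | suc k , inj₁ c≡ | s≤s c≤2q = inj₁ (k , *-cancelˡ-≤ 2 (subst (_≤ 2 * q) c≡ c≤2q) ,
                                              trans (cong pos (trans (double-suc k) (sym c≡))) (pos-toℕ c))
  ... | k , inj₂ c≡ | s≤s c≤2q with complement (*-cancelˡ-≤ 2 (≤-trans (n≤1+n (2 * k)) (subst (_≤ 2 * q) c≡ c≤2q)))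
  ...   | k′ , e = inj₂ (k′ , subst (k′ ≤_) e (m≤n+m k′ k) , trans (neg-≈ (2 * k′) 2k′+c≈0) (pos-toℕ c))
    where
    2k′+c≈0 : 2 * k′ + toℕ c ≈ 0
    2k′+c≈0 = ≈-trans (≡⇒≈ (trans (cong (2 * k′ +_) c≡) (odd-split k k′ e))) p≈0

  tail-same : ∀ c → Near IT′ₚ (inj₁ c) (inj₂ c)
  tail-same c with residue-shape c
  ... | inj₁ (k , k<q , refl) = Near-T′⇒Near (T′-plus k k<q)
  ... | inj₂ (k , k≤q , refl) = Near-T′⇒Near (Near-sym (T′-minus k k≤q))

  tail-cross : ∀ j → 1 ≤ j → j ≤ q → ∀ m n → m + j ≈ 1 → n ≈ 1 + j →
               Near IT′ₚ (inj₁ (pos m)) (inj₁ (pos n))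
  tail-cross j 1≤j j≤q m n m+j≈1 n≈1+j with parity j
  tail-cross .0 () _ _ _ _ _ | zero , inj₁ refl
  -- j = 2k + 1: the pair is (t_{4k+2}, t_{4k+3}) = (-2k, 2k + 2)
  ... | k , inj₂ refl = Near-T′⇒Near (subst₂ (Near T′) (cong inj₁ m≡) (cong inj₁ (pos-≈ (≈-sym n≈1+j)))
                          (T′-cross k (odd≤q⇒<q j≤q)))
    where
    shift : ∀ k m → 2 * k + m + 1 ≡ m + suc (2 * k)
    shift = solve-∀
    m≡ : neg (2 * k) ≡ pos m
    m≡ = neg-≈ (2 * k) (≈-cancelʳ 1 (≈-trans (≡⇒≈ (shift k m)) m+j≈1))
  -- j = 2k: with k + k′ = q the pair is (t_{4k′+3}, t_{4k′+2}) = (2k′ + 2, -2k′)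
  ... | suc k₀ , inj₁ refl with complement (≤-trans (m≤m+n (suc k₀) (suc k₀ + 0)) j≤q)
  ...   | k′ , e = Near-T′⇒Near (subst₂ (Near T′) (cong inj₁ m≡) (cong inj₁ n≡)
                     (Near-sym (T′-cross k′ (subst (k′ <_) e (m<n+m k′ (s≤s z≤n))))))
    where
    k : ℕ
    k = suc k₀
    m≡ : pos (2 + 2 * k′) ≡ pos m
    m≡ = pos-≈ (≈-cancelʳ {2 + 2 * k′} {m} (2 * k) (begin
      2 + 2 * k′ + 2 * k       ≡⟨ even-split k k′ e ⟩
      1 + p                    ≈⟨ ≈-+ (≈-refl {1}) p≈0 ⟩
      1                        ≈⟨ m+j≈1 ⟨
      m + 2 * k                ∎))
      where open ≈-Reasoning
    n≡ : neg (2 * k′) ≡ pos n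
    n≡ = neg-≈ (2 * k′) (begin
      2 * k′ + n               ≈⟨ ≈-+ (≈-refl {2 * k′}) n≈1+j ⟩
      2 * k′ + suc (2 * k)     ≡⟨ odd-split k k′ e ⟩
      p                        ≈⟨ p≈0 ⟩
      0                        ∎)
      where open ≈-Reasoning

  tail-wrap : ∀ j → 1 ≤ j → j ≤ q → ∀ m n → m + j ≈ 0 → n ≈ j →
              Near IT′ₚ (inj₂ (pos m)) (inj₂ (pos n))
  tail-wrap j 1≤j j≤q m n m+j≈0 n≈j with parity j
  tail-wrap .0 () _ _ _ _ _ | zero , inj₁ refl
  -- j = 2k + 2: the pair is (t_{4k+5}, t_{4k+4}) = (-2k-2̲, 2k + 2̲)
  ... | suc k , inj₁ refl = Near-T′⇒Near (subst₂ (Near T′) (cong inj₂ m≡) (cong inj₂ n≡)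
                              (Near-sym (T′-wrap k (≤-trans (s≤s (m≤m+n k (suc k + 0))) j≤q))))
    where
    m≡ : neg (2 * suc k) ≡ pos m
    m≡ = neg-≈ (2 * suc k) (≈-trans (≡⇒≈ (+-comm (2 * suc k) m)) m+j≈0)
    n≡ : pos (2 + 2 * k) ≡ pos n
    n≡ = pos-≈ (≈-sym (≈-trans n≈j (≡⇒≈ (sym (double-suc k)))))
  -- j = 2k + 1: with k + k′ = q the pair is (t_{4k′}, t_{4k′+1}) = (2k′̲, -2k′̲)
  ... | k , inj₂ refl with complement (<⇒≤ (odd≤q⇒<q j≤q)) | odd≤q⇒<q j≤q
  ...   | zero , e | k<q = contradiction (trans (sym (+-identityʳ k)) e) (<⇒≢ k<q)
  ...   | suc k₀ , e | _ = Near-T′⇒Near (subst₂ (Near T′) (cong inj₂ m≡) (cong inj₂ n≡)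
                             (T′-wrap k₀ (subst (k₀ <_) e (m≤n+m (suc k₀) k))))
    where
    m≡ : pos (2 + 2 * k₀) ≡ pos m
    m≡ = pos-≈ (≈-cancelʳ {2 + 2 * k₀} {m} (suc (2 * k)) (begin
      2 + 2 * k₀ + suc (2 * k)      ≡⟨ cong (_+ suc (2 * k)) (double-suc k₀) ⟩
      2 * suc k₀ + suc (2 * k)      ≡⟨ odd-split k (suc k₀) e ⟩
      p                             ≈⟨ p≈0 ⟩
      0                             ≈⟨ m+j≈0 ⟨
      m + suc (2 * k)               ∎))
      where open ≈-Reasoning
    n≡ : neg (2 * suc k₀) ≡ pos n
    n≡ = neg-≈ (2 * suc k₀) (begin
      2 * suc k₀ + n                ≈⟨ ≈-+ (≈-refl {2 * suc k₀}) n≈j ⟩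
      2 * suc k₀ + suc (2 * k)      ≡⟨ odd-split k (suc k₀) e ⟩
      p                             ≈⟨ p≈0 ⟩
      0                             ∎)
      where open ≈-Reasoning

-- Each row j ≤ q is covered cyclically:
-- x^{(j)}_m is near x^{(j)}_{m+1} and x^{(j)}_{m+2} for every m < 2p.  Inside
-- I′ j and I″ j this holds by position, across the cut and across the end
-- of the row by the blocks that follow I′ j and I″ j, and the two pairs
-- straddling both places at distance two are supplied by T′.  Reading the
-- rows by residues, two letters at difference ±2j, resp. ±j, with
-- 1 ≤ j ≤ q are near, and every pair of distinct letters is of this form.
module Cover (q : ℕ) (pr : Prime (suc (2 * q))) (q≥1 : 1 ≤ q) where

  open import Data.Nat using (_∸_; z≤n; s≤s; _≟_; _≤?_)
  open import Data.Nat.Properties hiding (_≟_)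
  open import Data.Nat.Tactic.RingSolver using (solve-∀)
  open import Data.Fin using (toℕ)
  open import Data.Fin.Properties using (toℕ<n; toℕ-injective) renaming (_≟_ to _≟ᶠ_)
  open import Data.List using ([]; _∷_; _++_)
  open import Data.List.Membership.Propositional using (_∈_)
  open import Data.Product using (Σ)
  open import Data.Sum using (_⊎_; inj₁; inj₂)
  open import Relation.Nullary using (yes; no; contradiction)
  open import Relation.Binary.Definitions using (tri<; tri≈; tri>)
  open import Relation.Binary.PropositionalEquality hiding (J)
  open Windows
  open Slices
  open Parity
  open Layout q q≥1
  open Modular p
  open ParitySolutions q pr using (solution-of-parity)
  open Rows q pr q≥1
  open Tail q q≥1

  x-2p : ∀ j → x j (2 * p) ≡ inj₁ (pos 0)
  x-2p j = trans (x-even j p) (cong inj₁ (pos-≈ (≈-trans (≡⇒≈ (rearrange p j)) (*p≈0 (2 * j)))))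
    where
    rearrange : ∀ p j → 2 * p * j ≡ 2 * j * p
    rearrange = solve-∀

  last-index : ∀ {m} → suc m ≡ 2 * p → m ≡ suc (2 * (2 * q))
  last-index e = suc-injective (trans e (trans 2p≡4q+2 (cong (λ n → suc (suc n)) (four q))))
    where
    four : ∀ q → 4 * q ≡ 2 * (2 * q)
    four = solve-∀

  module Row (j : ℕ) (1≤j : 1 ≤ j) (j≤q : j ≤ q) where

    open OddInverse (r-spec j 1≤j j≤q)

    R : ℕ
    R = suc (2 * s)

    R≤2p : R ≤ 2 * p
    R≤2p = <⇒≤ r<2p

    R+rest : R + (2 * p ∸ R) ≡ 2 * p
    R+rest = m+[n∸m]≡n R≤2p

    I′-slice : I′ j ≡ slice (x j) 0 R
    I′-slice = trans (I′≡slice j (r≤2p j 1≤j j≤q)) (cong (slice (x j) 0) r≡)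

    I″-slice : I″ j ≡ slice (x j) R (2 * p ∸ R)
    I″-slice = trans (I″≡slice j (r≤2p j 1≤j j≤q)) (cong (λ n → slice (x j) n (2 * p ∸ n)) r≡)

    x-R : x j R ≡ inj₂ (pos 1)
    x-R = trans (x-odd j s) (cong inj₂ (pos-≈ inverse))

    across-cut : Σ (List Alph) λ Z → Factor (slice (x j) 0 R ++ x j R ∷ Z)
    across-cut with I′-followed j 1≤j j≤q
    ... | Z , F = Z , subst₂ (λ l y → Factor (l ++ y ∷ Z)) I′-slice (sym x-R) F

    across-end : Σ (List Alph) λ Z → Factor (slice (x j) R (2 * p ∸ R) ++ x j (2 * p) ∷ Z)
    across-end with I″-followed j 1≤j j≤q
    ... | Z , F = Z , subst₂ (λ l y → Factor (l ++ y ∷ Z)) I″-slice (sym (x-2p j)) F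

    in-first : ∀ {a b} → Adj (slice (x j) 0 R) a b → Adj IT′ₚ a b
    in-first ad with across-cut
    ... | Z , F = Factor-Adj F (Adj-infix [] (x j R ∷ Z) ad)

    in-second : ∀ {a b} → Adj (slice (x j) R (2 * p ∸ R)) a b → Adj IT′ₚ a b
    in-second ad with across-end
    ... | Z , F = Factor-Adj F (Adj-infix [] (x j (2 * p) ∷ Z) ad)

    -- the pairs (x_{R-1}, x_{R+1}) = (1 - j, 1 + j) and (x_{2p-1}, x_{2p+1}) = (-j̲, j̲) come from T′
    cross-pair : Near IT′ₚ (x j (2 * s)) (x j (suc (suc (2 * s))))
    cross-pair = subst₂ (Near IT′ₚ) (sym (x-even j s)) (sym (trans (cong (x j) (double-suc s)) (x-even j (suc s))))
      (tail-cross j 1≤j j≤q (2 * s * j) (2 * suc s * j) (≈-trans (≡⇒≈ (before s j)) inverse)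
                  (≈-trans (≡⇒≈ (after s j)) (≈-+ inverse ≈-refl)))
      where
      before : ∀ s j → 2 * s * j + j ≡ suc (2 * s) * j
      before = solve-∀
      after : ∀ s j → 2 * suc s * j ≡ suc (2 * s) * j + j
      after = solve-∀

    wrap-pair : Near IT′ₚ (x j (suc (2 * (2 * q)))) (x j (suc (suc (suc (2 * (2 * q))))))
    wrap-pair = subst₂ (Near IT′ₚ) (sym (x-odd j (2 * q))) (sym (trans (cong (x j) (three q)) (x-odd j p)))
      (tail-wrap j 1≤j j≤q (suc (2 * (2 * q)) * j) (suc (2 * p) * j)
                 (≈-trans (≡⇒≈ (before q j)) (*p≈0 (2 * j)))
                 (≈-trans (≡⇒≈ (after q j)) (+*p j (2 * j))))
      where
      three : ∀ q → suc (suc (suc (2 * (2 * q)))) ≡ suc (2 * suc (2 * q))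
      three = solve-∀
      before : ∀ q j → suc (2 * (2 * q)) * j + j ≡ 2 * j * suc (2 * q)
      before = solve-∀
      after : ∀ q j → suc (2 * suc (2 * q)) * j ≡ j + 2 * j * suc (2 * q)
      after = solve-∀

    second-half₁ : ∀ m → R ≤ m → m < 2 * p → Near IT′ₚ (x j m) (x j (suc m))
    second-half₁ m R≤m m<2p with <-cmp (suc m) (2 * p)
    ... | tri< m+1<2p _ _ =
      inj₁ (in-second (Succ⇒Adj (Succ-slice (x j) R (2 * p ∸ R) m R≤m (subst (suc m <_) (sym R+rest) m+1<2p))))
    ... | tri≈ _ m+1≡2p _ with across-end
    ...   | Z , F = inj₁ (subst (λ i → Adj IT′ₚ (x j m) (x j i)) (sym m+1≡2p)
                      (Factor-Adj F (Adj-slice-end₁ (x j) R (2 * p ∸ R) m (x j (2 * p)) Z R≤m (trans m+1≡2p (sym R+rest)))))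
    second-half₁ m R≤m m<2p | tri> _ _ 2p<m+1 = contradiction m<2p (<⇒≱ 2p<m+1)

    second-half₂ : ∀ m → R ≤ m → m < 2 * p → Near IT′ₚ (x j m) (x j (suc (suc m)))
    second-half₂ m R≤m m<2p with <-cmp (suc (suc m)) (2 * p)
    ... | tri< m+2<2p _ _ = inj₁ (in-second (Adj-slice₂ (x j) R (2 * p ∸ R) m R≤m (subst (suc (suc m) <_) (sym R+rest) m+2<2p)))
    ... | tri≈ _ m+2≡2p _ with across-end
    ...   | Z , F = inj₁ (subst (λ i → Adj IT′ₚ (x j m) (x j i)) (sym m+2≡2p)
                      (Factor-Adj F (Adj-slice-end₂ (x j) R (2 * p ∸ R) m (x j (2 * p)) Z R≤m (trans m+2≡2p (sym R+rest)))))
    second-half₂ m R≤m m<2p | tri> _ _ 2p<m+2 =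
      subst (λ i → Near IT′ₚ (x j i) (x j (suc (suc i)))) (sym (last-index (≤-antisym m<2p (≤-pred 2p<m+2)))) wrap-pair

    step₁ : ∀ m → m < 2 * p → Near IT′ₚ (x j m) (x j (suc m))
    step₁ m m<2p with <-cmp (suc m) R
    ... | tri< m+1<R _ _ = inj₁ (in-first (Succ⇒Adj (Succ-slice (x j) 0 R m z≤n m+1<R)))
    ... | tri≈ _ m+1≡R _ with across-cut
    ...   | Z , F = inj₁ (subst (λ i → Adj IT′ₚ (x j m) (x j i)) (sym m+1≡R)
                      (Factor-Adj F (Adj-slice-end₁ (x j) 0 R m (x j R) Z z≤n m+1≡R)))
    step₁ m m<2p | tri> _ _ R<m+1 = second-half₁ m (≤-pred R<m+1) m<2p

    step₂ : ∀ m → m < 2 * p → Near IT′ₚ (x j m) (x j (suc (suc m)))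
    step₂ m m<2p with <-cmp (suc (suc m)) R
    ... | tri< m+2<R _ _ = inj₁ (in-first (Adj-slice₂ (x j) 0 R m z≤n m+2<R))
    ... | tri≈ _ m+2≡R _ with across-cut
    ...   | Z , F = inj₁ (subst (λ i → Adj IT′ₚ (x j m) (x j i)) (sym m+2≡R)
                      (Factor-Adj F (Adj-slice-end₂ (x j) 0 R m (x j R) Z z≤n m+2≡R)))
    step₂ m m<2p | tri> _ _ R<m+2 with suc m ≟ R
    ...   | yes m+1≡R = subst (λ i → Near IT′ₚ (x j i) (x j (suc (suc i)))) (sym (suc-injective m+1≡R)) cross-pair
    ...   | no m+1≢R = second-half₂ m (≤-pred (≤∧≢⇒< (≤-pred R<m+2) (λ e → m+1≢R (sym e)))) m<2p

  x-at-even : ∀ j k (c : Fin p) → 2 * k * j ≈ toℕ c → x j (2 * k) ≡ inj₁ c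
  x-at-even j k c e = trans (x-even j k) (cong inj₁ (trans (pos-≈ e) (pos-toℕ c)))

  x-at-odd : ∀ j k (c : Fin p) → suc (2 * k) * j ≈ toℕ c → x j (suc (2 * k)) ≡ inj₂ c
  x-at-odd j k c e = trans (x-odd j k) (cong inj₂ (trans (pos-≈ e) (pos-toℕ c)))

  private
    two-steps : ∀ k j → 2 * suc k * j ≡ 2 * k * j + 2 * j
    two-steps = solve-∀

    two-steps′ : ∀ k j → suc (2 * suc k) * j ≡ suc (2 * k) * j + 2 * j
    two-steps′ = solve-∀

    one-step : ∀ k j → 2 * suc k * j ≡ suc (2 * k) * j + j
    one-step = solve-∀

  near-AA : ∀ j → 1 ≤ j → j ≤ q → ∀ (c e : Fin p) → toℕ c + 2 * j ≈ toℕ e → Near IT′ₚ (inj₁ c) (inj₁ e)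
  near-AA j 1≤j j≤q c e c+2j≈e with solution-of-parity 0 z≤n j (toℕ c) 1≤j (≤-<-trans j≤q q<p)
  ... | k , 2k<2p , 2kj≈c = subst₂ (Near IT′ₚ) (x-at-even j k c 2kj≈c)
    (trans (cong (x j) (double-suc k)) (x-at-even j (suc k) e (begin
      2 * suc k * j                ≡⟨ two-steps k j ⟩
      2 * k * j + 2 * j            ≈⟨ ≈-+ 2kj≈c ≈-refl ⟩
      toℕ c + 2 * j                ≈⟨ c+2j≈e ⟩
      toℕ e                        ∎)))
    (Row.step₂ j 1≤j j≤q (2 * k) 2k<2p)
    where open ≈-Reasoning

  near-UU : ∀ j → 1 ≤ j → j ≤ q → ∀ (c e : Fin p) → toℕ c + 2 * j ≈ toℕ e → Near IT′ₚ (inj₂ c) (inj₂ e)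
  near-UU j 1≤j j≤q c e c+2j≈e with solution-of-parity 1 (s≤s z≤n) j (toℕ c) 1≤j (≤-<-trans j≤q q<p)
  ... | k , 2k+1<2p , [2k+1]j≈c = subst₂ (Near IT′ₚ) (x-at-odd j k c [2k+1]j≈c)
    (trans (cong (λ i → x j (suc i)) (double-suc k)) (x-at-odd j (suc k) e (begin
      suc (2 * suc k) * j          ≡⟨ two-steps′ k j ⟩
      suc (2 * k) * j + 2 * j      ≈⟨ ≈-+ [2k+1]j≈c ≈-refl ⟩
      toℕ c + 2 * j                ≈⟨ c+2j≈e ⟩
      toℕ e                        ∎)))
    (Row.step₂ j 1≤j j≤q (suc (2 * k)) 2k+1<2p)
    where open ≈-Reasoning

  near-AU : ∀ j → 1 ≤ j → j ≤ q → ∀ (c e : Fin p) → toℕ c + j ≈ toℕ e → Near IT′ₚ (inj₁ c) (inj₂ e)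
  near-AU j 1≤j j≤q c e c+j≈e with solution-of-parity 0 z≤n j (toℕ c) 1≤j (≤-<-trans j≤q q<p)
  ... | k , 2k<2p , 2kj≈c = subst₂ (Near IT′ₚ) (x-at-even j k c 2kj≈c)
    (x-at-odd j k e (begin
      j + 2 * k * j                ≡⟨ +-comm j (2 * k * j) ⟩
      2 * k * j + j                ≈⟨ ≈-+ 2kj≈c ≈-refl ⟩
      toℕ c + j                    ≈⟨ c+j≈e ⟩
      toℕ e                        ∎))
    (Row.step₁ j 1≤j j≤q (2 * k) 2k<2p)
    where open ≈-Reasoning

  near-UA : ∀ j → 1 ≤ j → j ≤ q → ∀ (c e : Fin p) → toℕ c + j ≈ toℕ e → Near IT′ₚ (inj₂ c) (inj₁ e)
  near-UA j 1≤j j≤q c e c+j≈e with solution-of-parity 1 (s≤s z≤n) j (toℕ c) 1≤j (≤-<-trans j≤q q<p)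
  ... | k , 2k+1<2p , [2k+1]j≈c = subst₂ (Near IT′ₚ) (x-at-odd j k c [2k+1]j≈c)
    (trans (cong (x j) (double-suc k)) (x-at-even j (suc k) e (begin
      2 * suc k * j                ≡⟨ one-step k j ⟩
      suc (2 * k) * j + j          ≈⟨ ≈-+ [2k+1]j≈c ≈-refl ⟩
      toℕ c + j                    ≈⟨ c+j≈e ⟩
      toℕ e                        ∎)))
    (Row.step₁ j 1≤j j≤q (suc (2 * k)) 2k+1<2p)
    where open ≈-Reasoning

  difference : ∀ (c e : Fin p) → c ≢ e → Σ ℕ λ δ → 0 < δ × δ < p × toℕ c + δ ≈ toℕ e
  difference c e c≢e with <-cmp (toℕ c) (toℕ e)
  ... | tri≈ _ c≡e _ = contradiction (toℕ-injective c≡e) c≢e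
  ... | tri< c<e _ _ = toℕ e ∸ toℕ c , m<n⇒0<n∸m c<e , ≤-<-trans (m∸n≤m (toℕ e) (toℕ c)) (toℕ<n e) ,
                       ≡⇒≈ (m+[n∸m]≡n (<⇒≤ c<e))
  ... | tri> _ _ e<c with m≤n⇒∃[o]m+o≡n (<⇒≤ e<c)
  ...   | d , e+d≡c = p ∸ d , m<n⇒0<n∸m d<p , ∸-monoʳ-< 0<d (<⇒≤ d<p) , (begin
    toℕ c + (p ∸ d)              ≡⟨ cong (_+ (p ∸ d)) e+d≡c ⟨
    toℕ e + d + (p ∸ d)          ≡⟨ +-assoc (toℕ e) d (p ∸ d) ⟩
    toℕ e + (d + (p ∸ d))        ≡⟨ cong (toℕ e +_) (m+[n∸m]≡n (<⇒≤ d<p)) ⟩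
    toℕ e + p                    ≈⟨ +p (toℕ e) ⟩
    toℕ e                        ∎)
    where
    open ≈-Reasoning
    d<p : d < p
    d<p = ≤-<-trans (m≤n+m d (toℕ e)) (subst (_< p) (sym e+d≡c) (toℕ<n c))
    0<d : 0 < d
    0<d = n≢0⇒n>0 λ { refl → <-irrefl (trans (sym (+-identityʳ (toℕ e))) e+d≡c) e<c }

  complementary : ∀ {a b} δ u → δ + u ≡ p → a + δ ≈ b → b + u ≈ a
  complementary {a} {b} δ u δ+u≡p a+δ≈b = begin
    b + u                        ≈⟨ ≈-+ (≈-sym a+δ≈b) ≈-refl ⟩
    a + δ + u                    ≡⟨ trans (+-assoc a δ u) (cong (a +_) δ+u≡p) ⟩
    a + p                        ≈⟨ +p a ⟩
    a                            ∎
    where open ≈-Reasoning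

  even-difference : ∀ (c e : Fin p) → c ≢ e →
    Σ ℕ λ j → 1 ≤ j × j ≤ q × (toℕ c + 2 * j ≈ toℕ e ⊎ toℕ e + 2 * j ≈ toℕ c)
  even-difference c e c≢e with difference c e c≢e
  ... | δ , 0<δ , δ<p , c+δ≈e with parity δ
  ...   | suc j , inj₁ refl = suc j , s≤s z≤n , *-cancelˡ-≤ 2 (≤-pred δ<p) , inj₁ c+δ≈e
  ...   | zero , inj₁ refl = contradiction 0<δ λ ()
  even-difference c e c≢e | δ , 0<δ , δ<p , c+δ≈e | t , inj₂ refl with m≤n⇒∃[o]m+o≡n (*-cancelˡ-< 2 t q (≤-pred δ<p))
  ...   | u , t+1+u≡q = suc u , s≤s z≤n , subst (suc u ≤_) t+1+u≡q (s≤s (m≤n+m u t)) ,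
                        inj₂ (complementary (suc (2 * t)) (2 * suc u) δ+2u≡p c+δ≈e)
    where
    split : ∀ t u → suc (2 * t) + 2 * suc u ≡ suc (2 * (suc t + u))
    split = solve-∀
    δ+2u≡p : suc (2 * t) + 2 * suc u ≡ p
    δ+2u≡p = trans (split t u) (cong (λ n → suc (2 * n)) t+1+u≡q)

  small-difference : ∀ (c e : Fin p) → c ≢ e →
    Σ ℕ λ j → 1 ≤ j × j ≤ q × (toℕ c + j ≈ toℕ e ⊎ toℕ e + j ≈ toℕ c)
  small-difference c e c≢e with difference c e c≢e
  ... | δ , 0<δ , δ<p , c+δ≈e with δ ≤? q
  ...   | yes δ≤q = δ , 0<δ , δ≤q , inj₁ c+δ≈e
  ...   | no δ≰q with m≤n⇒∃[o]m+o≡n (<⇒≤ δ<p)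
  ...     | u , δ+u≡p = u , 0<u , u≤q , inj₂ (complementary δ u δ+u≡p c+δ≈e)
    where
    0<u : 0 < u
    0<u = n≢0⇒n>0 λ { refl → <-irrefl (trans (sym (+-identityʳ δ)) δ+u≡p) δ<p }
    u≤q : u ≤ q
    u≤q = +-cancelˡ-≤ (suc q) u q (≤-trans (+-monoˡ-≤ u (≰⇒> δ≰q)) (≤-reflexive (trans δ+u≡p (q+q q))))
      where
      q+q : ∀ q → suc (2 * q) ≡ suc q + q
      q+q = solve-∀

  near-mixed : ∀ (c e : Fin p) → Near IT′ₚ (inj₁ c) (inj₂ e)
  near-mixed c e with c ≟ᶠ e
  ... | yes refl = tail-same c
  ... | no c≢e with small-difference c e c≢e
  ...   | j , 1≤j , j≤q , inj₁ c+j≈e = near-AU j 1≤j j≤q c e c+j≈e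
  ...   | j , 1≤j , j≤q , inj₂ e+j≈c = Near-sym (near-UA j 1≤j j≤q e c e+j≈c)

  near-all : ∀ a b → a ≡ b ⊎ Near IT′ₚ a b
  near-all (inj₁ c) (inj₁ e) with c ≟ᶠ e
  ... | yes refl = inj₁ refl
  ... | no c≢e with even-difference c e c≢e
  ...   | j , 1≤j , j≤q , inj₁ c+2j≈e = inj₂ (near-AA j 1≤j j≤q c e c+2j≈e)
  ...   | j , 1≤j , j≤q , inj₂ e+2j≈c = inj₂ (Near-sym (near-AA j 1≤j j≤q e c e+2j≈c))
  near-all (inj₂ c) (inj₂ e) with c ≟ᶠ e
  ... | yes refl = inj₁ refl
  ... | no c≢e with even-difference c e c≢e
  ...   | j , 1≤j , j≤q , inj₁ c+2j≈e = inj₂ (near-UU j 1≤j j≤q c e c+2j≈e)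
  ...   | j , 1≤j , j≤q , inj₂ e+2j≈c = inj₂ (Near-sym (near-UU j 1≤j j≤q e c e+2j≈c))
  near-all (inj₁ c) (inj₂ e) = inj₂ (near-mixed c e)
  near-all (inj₂ c) (inj₁ e) = inj₂ (Near-sym (near-mixed e c))

  IT′-two-radius : IsTwoRadius IT′ₚ
  IT′-two-radius = two-radius-by-windows IT′ₚ occurs near-all
    where
    occurs : ∀ a → a ∈ IT′ₚ
    occurs (inj₁ c) = Near-∈ˡ (tail-same c)
    occurs (inj₂ c) = Near-∈ʳ (tail-same c)

-- The length of IT′ is q · 2p + (2p) = p² + p: the blocks J j, Ĵ j together
-- form row j, of length 2p, and T′ has length 2p.
module Length (q : ℕ) (q≥1 : 1 ≤ q) where

  open import Data.List using ([]; _∷_; _++_; concat; map; reverse; upTo)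
  open import Data.List.Properties
  open import Data.Bool using (true; false; if_then_else_)
  open import Data.Nat.Properties using (+-comm)
  open import Data.Nat.Tactic.RingSolver using (solve-∀)
  open import Relation.Binary.PropositionalEquality hiding (J)
  open Slices
  open Layout q q≥1

  length-concat-reverse : ∀ {A : Set} (Ls : List (List A)) → length (concat (reverse Ls)) ≡ length (concat Ls)
  length-concat-reverse [] = refl
  length-concat-reverse (L ∷ Ls) = begin
    length (concat (reverse (L ∷ Ls)))            ≡⟨ cong (λ l → length (concat l)) (unfold-reverse L Ls) ⟩
    length (concat (reverse Ls ++ L ∷ []))        ≡⟨ cong length (concat-++ (reverse Ls) (L ∷ [])) ⟨
    length (concat (reverse Ls) ++ L ++ [])       ≡⟨ length-++ (concat (reverse Ls)) ⟩
    length (concat (reverse Ls)) + length (L ++ [])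
      ≡⟨ cong₂ _+_ (length-concat-reverse Ls) (cong length (++-identityʳ L)) ⟩
    length (concat Ls) + length L                 ≡⟨ +-comm (length (concat Ls)) (length L) ⟩
    length L + length (concat Ls)                 ≡⟨ length-++ L ⟨
    length (concat (L ∷ Ls))                      ∎
    where open ≡-Reasoning

  length-J+Ĵ : ∀ j → length (J j) + length (Ĵ j) ≡ 2 * p
  length-J+Ĵ j = begin
    length (J j) + length (Ĵ j)                   ≡⟨ halves (even j) ⟩
    length (I′ j) + length (I″ j)                 ≡⟨ length-++ (I′ j) ⟨
    length (I′ j ++ I″ j)                         ≡⟨ cong length (take++drop≡id (r j) (row j)) ⟩
    length (row j)                                ≡⟨ length-map (x j) (upTo (2 * p)) ⟩
    length (upTo (2 * p))                         ≡⟨ length-upTo (2 * p) ⟩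
    2 * p                                         ∎
    where
    open ≡-Reasoning
    halves : ∀ b → length (if b then I″ j else I′ j) + length (if b then I′ j else I″ j) ≡ length (I′ j) + length (I″ j)
    halves true = +-comm (length (I″ j)) (length (I′ j))
    halves false = refl

  length-rows : ∀ (ns : List ℕ) → length (concat (map J ns)) + length (concat (map Ĵ ns)) ≡ length ns * (2 * p)
  length-rows [] = refl
  length-rows (j ∷ ns) = begin
    length (J j ++ concat (map J ns)) + length (Ĵ j ++ concat (map Ĵ ns))
      ≡⟨ cong₂ _+_ (length-++ (J j)) (length-++ (Ĵ j)) ⟩
    (length (J j) + length (concat (map J ns))) + (length (Ĵ j) + length (concat (map Ĵ ns)))
      ≡⟨ interchange (length (J j)) _ (length (Ĵ j)) _ ⟩
    (length (J j) + length (Ĵ j)) + (length (concat (map J ns)) + length (concat (map Ĵ ns)))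
      ≡⟨ cong₂ _+_ (length-J+Ĵ j) (length-rows ns) ⟩
    2 * p + length ns * (2 * p) ∎
    where
    open ≡-Reasoning
    interchange : ∀ a b c d → (a + b) + (c + d) ≡ (a + c) + (b + d)
    interchange = solve-∀

  length-IT′ : length IT′ₚ ≡ p * p + p
  length-IT′ = begin
    length (I ++ T′)                              ≡⟨ length-++ I ⟩
    length I + length T′                          ≡⟨ cong₂ _+_ (length-++ (concat (map J js))) (cong length T′≡) ⟩
    length (concat (map J js)) + length (concat (map Ĵ (reverse js))) + (2 + length (slice t 3 (4 * q)))
      ≡⟨ cong₂ (λ a b → length (concat (map J js)) + a + (2 + b)) reversed (length-slice t 3 (4 * q)) ⟩
    length (concat (map J js)) + length (concat (map Ĵ js)) + (2 + 4 * q)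
      ≡⟨ cong (_+ (2 + 4 * q)) (length-rows js) ⟩
    length js * (2 * p) + (2 + 4 * q)             ≡⟨ cong (λ n → n * (2 * p) + (2 + 4 * q)) length-js ⟩
    q * (2 * p) + (2 + 4 * q)                     ≡⟨ square q ⟩
    p * p + p                                     ∎
    where
    open ≡-Reasoning
    reversed : length (concat (map Ĵ (reverse js))) ≡ length (concat (map Ĵ js))
    reversed = trans (cong (λ l → length (concat l)) (reverse-map Ĵ js)) (length-concat-reverse (map Ĵ js))
    length-js : length js ≡ q
    length-js = trans (length-map suc (upTo h)) (trans (length-upTo h) h≡q)
    square : ∀ q → q * (2 * suc (2 * q)) + (2 + 4 * q) ≡ suc (2 * q) * suc (2 * q) + suc (2 * q)
    square = solve-∀

-- The alphabet Fin p ⊎ Fin p of the construction is Fin (2p) up to a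
-- bijection, so 2-radius sequences move between the two alphabets.
module Doubling (p : ℕ) where

  open import Data.Nat.Properties using (+-identityʳ)
  open import Data.Fin using (join; splitAt; cast)
  open import Data.Fin.Properties using (join-splitAt; cast-involutive)
  open import Data.Sum using (_⊎_; inj₁; inj₂; map₂)
  open import Relation.Binary.PropositionalEquality using (sym; trans; cong)

  to : Fin p ⊎ Fin p → Fin (2 * p)
  to s = join p (p + 0) (map₂ (cast (sym (+-identityʳ p))) s)

  from : Fin (2 * p) → Fin p ⊎ Fin p
  from i = map₂ (cast (+-identityʳ p)) (splitAt p i)

  to-from : ∀ i → to (from i) ≡ i
  to-from i = trans (cong (join p (p + 0)) (cast-back (splitAt p i))) (join-splitAt p (p + 0) i)
    where
    cast-back : ∀ s → map₂ (cast (sym (+-identityʳ p))) (map₂ (cast (+-identityʳ p)) s) ≡ s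
    cast-back (inj₁ a) = refl
    cast-back (inj₂ b) = cong inj₂ (cast-involutive (sym (+-identityʳ p)) (+-identityʳ p) b)

module OddPrime where

  open import Data.Nat using (s≤s)
  open import Data.Nat.Properties using (*-comm; <-irrefl; n≢0⇒n>0)
  open import Data.Nat.Primality using (prime⇒irreducible)
  open import Data.Nat.Divisibility using (divides)
  open import Data.Product using (Σ)
  open import Data.Sum using (inj₁; inj₂)
  open import Relation.Nullary using (contradiction)
  open Parity

  odd-prime : ∀ {p} → Prime p → 2 < p → Σ ℕ λ q → p ≡ suc (2 * q) × 1 ≤ q
  odd-prime {p} pr 2<p with parity p
  ... | k , inj₁ refl with prime⇒irreducible pr (divides k (*-comm 2 k))
  ...   | inj₁ ()
  ...   | inj₂ 2≡p = contradiction 2<p (<-irrefl 2≡p)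
  odd-prime pr 2<p | k , inj₂ refl = k , refl , n≢0⇒n>0 λ { refl → contradiction 2<p λ { (s≤s ()) } }

module Optimality (q : ℕ) (pr : Prime (suc (2 * q))) (q≥1 : 1 ≤ q) where

  open import Data.List using (map)
  open import Data.List.Properties using (length-map)
  open import Data.Nat.Properties using (module ≤-Reasoning)
  open import Relation.Binary.PropositionalEquality using (trans)
  open Windows
  open Layout q q≥1 using (p; IT′ₚ)
  open Cover q pr q≥1 using (IT′-two-radius)
  open Length q q≥1 public using (length-IT′)
  open Doubling p

  lower-bound : ∀ (xs : List (Fin (2 * p))) → IsTwoRadius xs → p * p + p ≤ length xs
  lower-bound = LowerBound.two-radius-lower-bound q

  f₂ : IsF2 (2 * p) (p * p + p)
  f₂ = (map to IT′ₚ , two-radius-map to from to-from IT′ₚ IT′-two-radius , trans (length-map to IT′ₚ) length-IT′)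
     , lower-bound

  -- any 2-radius sequence over Fin p ⊎ Fin p transfers to Fin (2p), of the same length
  IT′-shortest : IsShortestTwoRadius IT′ₚ
  IT′-shortest = IT′-two-radius , λ ys ys-two-radius → begin
    length IT′ₚ            ≡⟨ length-IT′ ⟩
    p * p + p              ≤⟨ lower-bound (map to ys) (two-radius-map to from to-from ys ys-two-radius) ⟩
    length (map to ys)     ≡⟨ length-map to ys ⟩
    length ys              ∎
    where open ≤-Reasoning

corollary5 : ∀ (p : ℕ) → (pr : Prime p) → 2 < p →
    (∀ (xs : List (Fin (2 * p))) → IsTwoRadius xs → p * p + p ≤ length xs)
    × IsF2 (2 * p) (p * p + p)
    × IsShortestTwoRadius (IT′ p {{prime⇒nonZero pr}})
    × length (IT′ p {{prime⇒nonZero pr}}) ≡ p * p + p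
corollary5 p pr 2<p with OddPrime.odd-prime pr 2<p
... | q , refl , q≥1 = lower-bound , f₂ , IT′-shortest , length-IT′
  where open Optimality q pr q≥1
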